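{- Let $r\in\mathbb{N}$, let $G=(g_1,\ldots,g_r)$ be any system of polynomials with integer coefficients, let $m_1,\ldots,m_r\in\mathbb{N}$ and $m=\operatorname{lcm}(m_1,\ldots,m_r)$. Define $$R_G(m_1,\ldots,m_r)=\sum_{\substack{k=1\\ \gcd(k,m)=1}}^m c_{m_1}(g_1(k))\cdots c_{m_r}(g_r(k)).$$ Then $$R_G(m_1,\ldots,m_r)=\phi(m)\sum_{d_1\mid m_1,\ldots,d_r\mid m_r}\frac{d_1\mu(m_1/d_1)\cdots d_r\mu(m_r/d_r)}{\phi(\operatorname{lcm}(d_1,\ldots,d_r))}\,\eta_G(d_1,\ldots,d_r).$$
   Context: For $n\in\mathbb{N}$ and $k\in\mathbb{Z}$, $c_n(k)=\sum_{1\le j\le n,\ \gcd(j,n)=1}\exp(2\pi i jk/n)$ is the Ramanujan sum. $\mu$ is the Möbius function and $\phi$ is Euler's totient function. For $d_1,\ldots,d_r\in\mathbb{N}$, $\eta_G(d_1,\ldots,d_r)$ denotes the number of residues $x$ modulo $\operatorname{lcm}(d_1,\ldots,d_r)$ satisfying simultaneously $g_1(x)\equiv 0 \pmod{d_1},\ldots,g_r(x)\equiv 0\pmod{d_r}$ and $\gcd(x,d_1)=\cdots=\gcd(x,d_r)=1$. -}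

module Defs where

open import Level using (Level)
open import Function using (_∘_)
open import Data.Bool using (Bool; true; false)
open import Data.Nat as ℕ using (ℕ; zero; suc; _≟_)
import Data.Nat.DivMod as ℕD
open import Data.Nat.Divisibility using (_∣?_)
open import Data.Nat.GCD using (gcd)
open import Data.Nat.LCM using (lcm)
open import Data.Nat.Primality using (prime?)
open import Data.Integer as ℤ using (ℤ; +_; -[1+_]; ∣_∣; 0ℤ; 1ℤ; -1ℤ)
open import Data.Integer.Divisibility as ℤD using ()
open import Data.Fin using (Fin) renaming (zero to fzero; suc to fsuc)
open import Data.Fin.Properties using (all?)
open import Data.List using (List; []; _∷_; [_]; map; filter; length; foldr; upTo; concatMap)
open import Data.Product using (_×_)
open import Relation.Nullary.Decidable using (_×-dec_)
open import Relation.Binary.PropositionalEquality using (_≡_)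
open import Algebra.Bundles using (CommutativeRing)

range1 : ℕ → List ℕ
range1 n = map suc (upTo n)

-- natural division; only ever used when the divisor is positive and
-- divides the dividend exactly (junk value 0 for divisor 0)
divN : ℕ → ℕ → ℕ
divN a zero = 0
divN a (suc b) = ℕD._/_ a (suc b)

-- least non-negative residue of an integer modulo n (junk 0 for n = 0)
modN : ℤ → ℕ → ℕ
modN x zero = 0
modN x (suc n) = ℤ._%ℕ_ x (suc n)

coprimeList : ℕ → List ℕ
coprimeList n = filter (λ j → gcd j n ≟ 1) (range1 n)

φ : ℕ → ℕ
φ n = length (coprimeList n)

μ : ℕ → ℤ
μ n with length (filter (λ d → (d ℕ.* d) ∣? n) (map (2 ℕ.+_) (upTo n)))
... | zero  = -1ℤ ℤ.^ length (filter (λ p → prime? p ×-dec (p ∣? n)) (range1 n))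
... | suc _ = 0ℤ

divisors : ℕ → List ℕ
divisors n = filter (_∣? n) (range1 n)

lcmF : ∀ {r} → (Fin r → ℕ) → ℕ
lcmF {zero} f = 1
lcmF {suc r} f = lcm (f fzero) (lcmF (f ∘ fsuc))

sumℤ : List ℤ → ℤ
sumℤ = foldr ℤ._+_ 0ℤ

prodFinℤ : ∀ {r} → (Fin r → ℤ) → ℤ
prodFinℤ {zero} f = 1ℤ
prodFinℤ {suc r} f = f fzero ℤ.* prodFinℤ (f ∘ fsuc)

consF : ∀ {r} → ℕ → (Fin r → ℕ) → Fin (suc r) → ℕ
consF d t fzero = d
consF d t (fsuc i) = t i

divisorTuples : ∀ {r} → (Fin r → ℕ) → List (Fin r → ℕ)
divisorTuples {zero} ms = [ (λ ()) ]
divisorTuples {suc r} ms =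
  concatMap (λ d → map (consF d) (divisorTuples (ms ∘ fsuc))) (divisors (ms fzero))

-- Polynomials with integer coefficients: coefficient lists,
-- constant term first.

Poly : Set
Poly = List ℤ

eval : Poly → ℤ → ℤ
eval [] x = 0ℤ
eval (a ∷ as) x = a ℤ.+ x ℤ.* eval as x

-- η_G(d_1,...,d_r): number of residues x mod lcm(d_1,...,d_r)
-- (represented by 0 ≤ x < lcm) with d_i ∣ g_i(x) and gcd(x,d_i) = 1 for all i

η : ∀ {r} → (Fin r → Poly) → (Fin r → ℕ) → ℕ
η {r} G ds = length (filter P? (upTo (lcmF ds)))
  where
  P? : (x : ℕ) → _
  P? x = all? {P = λ i → ((+ ds i) ℤD.∣ eval (G i) (+ x)) × (gcd x (ds i) ≡ 1)}
              (λ i → (ds i ∣? ∣ eval (G i) (+ x) ∣) ×-dec (gcd x (ds i) ≟ 1))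

-- The right-hand side of the theorem, as an integer:
-- Σ_{d_i ∣ m_i} (φ(m)/φ(lcm d)) · Π_i d_i μ(m_i/d_i) · η_G(d)
-- (φ(lcm d) divides φ(m) since lcm d ∣ m, so the division is exact)
rhsℤ : ∀ {r} → (Fin r → Poly) → (Fin r → ℕ) → ℤ
rhsℤ G ms = sumℤ (map term (divisorTuples ms))
  where
  term : _ → ℤ
  term d = (+ divN (φ (lcmF ms)) (φ (lcmF d)))
           ℤ.* prodFinℤ (λ i → (+ d i) ℤ.* μ (divN (ms i) (d i)))
           ℤ.* (+ η G d)

-- Ring-valued notions: exponentials exp(2πi t/n) are realised as powers
-- of a primitive n-th root of unity ω in a commutative ring.

module _ {c ℓ : Level} (R : CommutativeRing c ℓ) where
  open CommutativeRing R

  pow : Carrier → ℕ → Carrier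
  pow x zero = 1#
  pow x (suc n) = x * pow x n

  sumR : List Carrier → Carrier
  sumR = foldr _+_ 0#

  prodFinR : ∀ {r} → (Fin r → Carrier) → Carrier
  prodFinR {zero} f = 1#
  prodFinR {suc r} f = f fzero * prodFinR (f ∘ fsuc)

  natR : ℕ → Carrier
  natR zero = 0#
  natR (suc n) = 1# + natR n

  embedℤ : ℤ → Carrier
  embedℤ (+ n) = natR n
  embedℤ -[1+ n ] = - natR (suc n)

  -- Ramanujan sum c_n(x) = Σ_{1≤j≤n, gcd(j,n)=1} ω^{jx}, where ω plays the
  -- role of exp(2πi/n); the exponent jx is reduced mod n.
  ramanujan : Carrier → ℕ → ℤ → Carrier
  ramanujan ω n x = sumR (map (λ j → pow ω (modN ((+ j) ℤ.* x) n)) (coprimeList n))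

  -- R_G(m_1,...,m_r), where ζ plays the role of exp(2πi/m), m = lcm(m_i),
  -- so that exp(2πi/m_i) = ζ^(m/m_i).
  RG : ∀ {r} → Carrier → (Fin r → Poly) → (Fin r → ℕ) → Carrier
  RG ζ G ms = sumR (map (λ k → prodFinR (λ i →
                 ramanujan (pow ζ (divN (lcmF ms) (ms i))) (ms i) (eval (G i) (+ k))))
              (coprimeList (lcmF ms)))

module Submission where

-- Put m = lcm(m₁,…,mᵣ).  Each Ramanujan sum is first evaluated by von
-- Sterneck's formula  c_n(x) = Σ_{d ∣ n} d μ(n/d) [d ∣ x],  valid in every
-- commutative ring without zero divisors containing a primitive n-th root of
-- unity ω: sieve the condition gcd(j, n) = 1 with the Möbius function, and
-- sum the resulting geometric progressions of powers of ω.  Expanding the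
-- product Π_i c_{mᵢ}(gᵢ(k)) over divisor tuples d turns R_G into the integer
--   Σ_d Π_i dᵢ μ(mᵢ/dᵢ) · #{k ∈ (ℤ/m)ˣ : dᵢ ∣ gᵢ(k) for all i}.
-- Whether dᵢ ∣ gᵢ(k) depends only on k mod L, L = lcm(d) ∣ m, and the reduced
-- residues modulo m are equidistributed over the reduced residues modulo L
-- (every fibre has φ(m)/φ(L) elements), so the count is (φ(m)/φ(L)) η_G(d).

open import Defs
open import Level using (Level)
open import Function using (_∘_)
open import Data.Nat as ℕ using (ℕ; zero; suc; _≤_; _<_; z≤n; s≤s; NonZero)
import Data.Nat.Properties as ℕₚ
open import Data.Nat.Divisibility
import Data.Nat.DivMod as DM
open import Data.Nat.DivMod using (_%_; _/_)
open import Data.Nat.GCD using (gcd; gcd[m,n]∣m; gcd[m,n]∣n; gcd-greatest; gcd[m,n]≤n; gcd[m,n]≢0; gcd-zeroˡ; gcd-identityˡ; module Bézout)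
open import Data.Nat.LCM using (lcm; m∣lcm[m,n]; n∣lcm[m,n]; lcm-least)
open import Data.Nat.Coprimality as Coprime using (Coprime; coprime-divisor; coprime-Bézout; coprime⇒gcd≡1; gcd≡1⇒coprime)
open import Data.Nat.Primality using (Prime; prime?; euclidsLemma; prime⇒irreducible; ¬prime[1]; prime⇒nonZero; prime⇒nonTrivial)
open import Data.Nat.Primality.Factorisation using (factorise)
open import Data.Nat.ListAction using (product)
open import Data.Integer as ℤ using (ℤ; +_; -[1+_]; 0ℤ; 1ℤ; -1ℤ; ∣_∣)
open import Data.Integer using () renaming (_+_ to _+ℤ_; _*_ to _*ℤ_; _-_ to _-ℤ_)
import Data.Integer.Properties as ℤₚ
import Data.Integer.DivMod as ℤDM
import Data.Integer.Divisibility.Signed as ℤ∣ₛ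
open import Data.Integer.Tactic.RingSolver using (solve-∀)
open import Data.Fin using (Fin) renaming (zero to fzero; suc to fsuc)
open import Data.Fin.Properties using (all?)
open import Data.List using (List; []; _∷_; [_]; _++_; map; filter; length; upTo; concatMap)
import Data.List.Properties as Listₚ
open import Data.List.Membership.Propositional using (_∈_; find)
open import Data.List.Membership.Propositional.Properties using (∈-filter⁺; ∈-filter⁻; ∈-map⁺; ∈-map⁻; ∈-upTo⁺; ∈-concatMap⁻)
open import Data.List.Relation.Unary.Any using (here; there)
open import Data.List.Relation.Unary.All using (_∷_)
open import Data.Product using (_×_; _,_; proj₁; proj₂; Σ-syntax)
open import Data.Sum using (_⊎_; inj₁; inj₂)
open import Data.Empty using (⊥; ⊥-elim)
open import Data.Maybe using (nothing)
open import Relation.Nullary using (Dec; yes; no; ¬_)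
open import Relation.Nullary.Decidable using (_×-dec_; ¬?)
open import Relation.Unary using (Pred; Decidable)
open import Relation.Binary.PropositionalEquality as P using (_≡_)
open import Relation.Binary.Bundles using (Setoid)
import Relation.Binary.Reasoning.Setoid as SetoidReasoning
open import Algebra.Bundles using (CommutativeRing)
open import Tactic.RingSolver.Core.AlmostCommutativeRing using (fromCommutativeRing)

private
  variable
    ℓ₁ ℓ₂ ℓ₃ ℓ₄ : Level
    A : Set ℓ₁
    B : Set ℓ₂

module Sum {c ℓ : Level} (R : CommutativeRing c ℓ) where
  open CommutativeRing R
  open import Relation.Binary.Reasoning.Setoid setoid
  open import Tactic.RingSolver.NonReflective (fromCommutativeRing R (λ _ → nothing)) using (solve; _⊜_; _⊕_; ⊝_)
  import Algebra.Properties.Group +-group as +-Group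

  ∑ : List A → (A → Carrier) → Carrier
  ∑ [] f = 0#
  ∑ (x ∷ xs) f = f x + ∑ xs f

  sumR-map : (xs : List A) (f : A → Carrier) → sumR R (map f xs) ≡ ∑ xs f
  sumR-map [] f = P.refl
  sumR-map (x ∷ xs) f = P.cong (λ s → f x + s) (sumR-map xs f)

  ∑-cong : (xs : List A) {f g : A → Carrier} → (∀ x → f x ≈ g x) → ∑ xs f ≈ ∑ xs g
  ∑-cong [] e = refl
  ∑-cong (x ∷ xs) e = +-cong (e x) (∑-cong xs e)

  ∑-cong∈ : (xs : List A) {f g : A → Carrier} → (∀ x → x ∈ xs → f x ≈ g x) → ∑ xs f ≈ ∑ xs g
  ∑-cong∈ [] e = refl
  ∑-cong∈ (x ∷ xs) e = +-cong (e x (here P.refl)) (∑-cong∈ xs (λ y y∈ → e y (there y∈)))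

  ∑-++ : (xs ys : List A) (f : A → Carrier) → ∑ (xs ++ ys) f ≈ ∑ xs f + ∑ ys f
  ∑-++ [] ys f = sym (+-identityˡ _)
  ∑-++ (x ∷ xs) ys f = trans (+-congˡ (∑-++ xs ys f)) (sym (+-assoc _ _ _))

  ∑-map : (xs : List A) (g : A → B) (f : B → Carrier) → ∑ (map g xs) f ≡ ∑ xs (f ∘ g)
  ∑-map [] g f = P.refl
  ∑-map (x ∷ xs) g f = P.cong (λ s → f (g x) + s) (∑-map xs g f)

  ∑-concatMap : (g : A → List B) (xs : List A) (f : B → Carrier) → ∑ (concatMap g xs) f ≈ ∑ xs (λ x → ∑ (g x) f)
  ∑-concatMap g [] f = refl
  ∑-concatMap g (x ∷ xs) f = trans (∑-++ (g x) (concatMap g xs) f) (+-congˡ (∑-concatMap g xs f))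

  ∑-0 : (xs : List A) → ∑ xs (λ _ → 0#) ≈ 0#
  ∑-0 [] = refl
  ∑-0 (x ∷ xs) = trans (+-identityˡ _) (∑-0 xs)

  ∑-1 : (xs : List A) → ∑ xs (λ _ → 1#) ≈ natR R (length xs)
  ∑-1 [] = refl
  ∑-1 (x ∷ xs) = +-congˡ (∑-1 xs)

  ∑-+ : (xs : List A) (f g : A → Carrier) → ∑ xs (λ x → f x + g x) ≈ ∑ xs f + ∑ xs g
  ∑-+ [] f g = sym (+-identityˡ _)
  ∑-+ (x ∷ xs) f g = trans (+-congˡ (∑-+ xs f g)) (interchange (f x) (g x) (∑ xs f) (∑ xs g))
    where
    interchange : ∀ a b c d → (a + b) + (c + d) ≈ (a + c) + (b + d)
    interchange = solve 4 (λ a b c d → ((a ⊕ b) ⊕ (c ⊕ d)) ⊜ ((a ⊕ c) ⊕ (b ⊕ d))) refl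

  ∑-neg : (xs : List A) (f : A → Carrier) → ∑ xs (λ x → - f x) ≈ - ∑ xs f
  ∑-neg [] f = sym +-Group.ε⁻¹≈ε
  ∑-neg (x ∷ xs) f = trans (+-congˡ (∑-neg xs f)) (solve 2 (λ a b → (⊝ a ⊕ ⊝ b) ⊜ (⊝ (a ⊕ b))) refl (f x) (∑ xs f))

  ∑-*ˡ : (xs : List A) (k : Carrier) (f : A → Carrier) → ∑ xs (λ x → k * f x) ≈ k * ∑ xs f
  ∑-*ˡ [] k f = sym (zeroʳ k)
  ∑-*ˡ (x ∷ xs) k f = trans (+-congˡ (∑-*ˡ xs k f)) (sym (distribˡ k _ _))

  ∑-*ʳ : (xs : List A) (k : Carrier) (f : A → Carrier) → ∑ xs (λ x → f x * k) ≈ ∑ xs f * k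
  ∑-*ʳ xs k f = begin
    ∑ xs (λ x → f x * k) ≈⟨ ∑-cong xs (λ x → *-comm (f x) k) ⟩
    ∑ xs (λ x → k * f x) ≈⟨ ∑-*ˡ xs k f ⟩
    k * ∑ xs f           ≈⟨ *-comm k _ ⟩
    ∑ xs f * k           ∎

  prodFinR-cong : ∀ {r} {f g : Fin r → Carrier} → (∀ i → f i ≈ g i) → prodFinR R f ≈ prodFinR R g
  prodFinR-cong {zero} e = refl
  prodFinR-cong {suc r} e = *-cong (e fzero) (prodFinR-cong (e ∘ fsuc))

  ∑-swap : (xs : List A) (ys : List B) (h : A → B → Carrier) →
           ∑ xs (λ x → ∑ ys (h x)) ≈ ∑ ys (λ y → ∑ xs (λ x → h x y))
  ∑-swap [] ys h = sym (∑-0 ys)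
  ∑-swap (x ∷ xs) ys h = trans (+-congˡ (∑-swap xs ys h)) (sym (∑-+ ys (h x) _))

  ind : {P : Set ℓ₃} → Dec P → Carrier
  ind (yes _) = 1#
  ind (no _) = 0#

  ind-cong : {P : Set ℓ₃} {Q : Set ℓ₄} (d : Dec P) (e : Dec Q) → (P → Q) → (Q → P) → ind d ≈ ind e
  ind-cong (yes _) (yes _) f g = refl
  ind-cong (yes x) (no ¬y) f g = ⊥-elim (¬y (f x))
  ind-cong (no ¬x) (yes y) f g = ⊥-elim (¬x (g y))
  ind-cong (no _) (no _) f g = refl

  ind-yes : {P : Set ℓ₃} (d : Dec P) → P → ind d ≈ 1#
  ind-yes (yes _) x = refl
  ind-yes (no ¬x) x = ⊥-elim (¬x x)

  ind-no : {P : Set ℓ₃} (d : Dec P) → ¬ P → ind d ≈ 0#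
  ind-no (yes x) ¬x = ⊥-elim (¬x x)
  ind-no (no _) ¬x = refl

  ind-× : {P : Set ℓ₃} {Q : Set ℓ₄} (d : Dec P) (e : Dec Q) → ind (d ×-dec e) ≈ ind d * ind e
  ind-× (yes _) (yes _) = sym (*-identityˡ _)
  ind-× (yes _) (no _) = sym (zeroʳ _)
  ind-× (no _) e = sym (zeroˡ _)

  ind-⊎ : {C : Set ℓ₁} {P : Set ℓ₃} {Q : Set ℓ₄} (dC : Dec C) (dP : Dec P) (dQ : Dec Q) →
          (C → P ⊎ Q) → (P → C) → (Q → C) → (P → Q → ⊥) → ind dC ≈ ind dP + ind dQ
  ind-⊎ (yes _) (yes x) (yes y) f g h k = ⊥-elim (k x y)
  ind-⊎ (yes _) (yes _) (no _) f g h k = sym (+-identityʳ _)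
  ind-⊎ (yes _) (no _) (yes _) f g h k = sym (+-identityˡ _)
  ind-⊎ (yes z) (no ¬x) (no ¬y) f g h k with f z
  ... | inj₁ x = ⊥-elim (¬x x)
  ... | inj₂ y = ⊥-elim (¬y y)
  ind-⊎ (no ¬z) (yes x) dQ f g h k = ⊥-elim (¬z (g x))
  ind-⊎ (no ¬z) (no _) (yes y) f g h k = ⊥-elim (¬z (h y))
  ind-⊎ (no _) (no _) (no _) f g h k = sym (+-identityʳ _)

  ind-split : {P : Set ℓ₃} (d : Dec P) (x : Carrier) → x ≈ ind d * x + ind (¬? d) * x
  ind-split (yes _) x = sym (trans (+-congʳ (*-identityˡ x)) (trans (+-congˡ (zeroˡ x)) (+-identityʳ x)))
  ind-split (no _) x = sym (trans (+-congʳ (zeroˡ x)) (trans (+-identityˡ _) (*-identityˡ x)))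

  ∑-filter : {P : Pred A ℓ₃} (P? : Decidable P) (xs : List A) (f : A → Carrier) →
             ∑ (filter P? xs) f ≈ ∑ xs (λ x → ind (P? x) * f x)
  ∑-filter P? [] f = refl
  ∑-filter P? (x ∷ xs) f with P? x
  ... | yes _ = +-cong (sym (*-identityˡ _)) (∑-filter P? xs f)
  ... | no _ = trans (∑-filter P? xs f) (trans (sym (+-identityˡ _)) (+-congʳ (sym (zeroˡ _))))

  length-filter : {P : Pred A ℓ₃} (P? : Decidable P) (xs : List A) →
                  natR R (length (filter P? xs)) ≈ ∑ xs (λ x → ind (P? x))
  length-filter P? xs = trans (sym (∑-1 (filter P? xs))) (trans (∑-filter P? xs (λ _ → 1#)) (∑-cong xs (λ x → *-identityʳ _)))

  ∑-upTo-suc : (n : ℕ) (f : ℕ → Carrier) → ∑ (upTo (suc n)) f ≈ ∑ (upTo n) f + f n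
  ∑-upTo-suc n f = begin
    ∑ (upTo (suc n)) f        ≡⟨ P.cong (λ l → ∑ l f) (P.sym (Listₚ.upTo-∷ʳ n)) ⟩
    ∑ (upTo n ++ [ n ]) f     ≈⟨ ∑-++ (upTo n) [ n ] f ⟩
    ∑ (upTo n) f + (f n + 0#) ≈⟨ +-congˡ (+-identityʳ _) ⟩
    ∑ (upTo n) f + f n        ∎

  ∑-upTo-cong : (n : ℕ) {f g : ℕ → Carrier} → (∀ i → i < n → f i ≈ g i) → ∑ (upTo n) f ≈ ∑ (upTo n) g
  ∑-upTo-cong zero e = refl
  ∑-upTo-cong (suc n) {f} {g} e = begin
    ∑ (upTo (suc n)) f ≈⟨ ∑-upTo-suc n f ⟩
    ∑ (upTo n) f + f n ≈⟨ +-cong (∑-upTo-cong n (λ i i<n → e i (ℕₚ.m<n⇒m<1+n i<n))) (e n ℕₚ.≤-refl) ⟩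
    ∑ (upTo n) g + g n ≈⟨ sym (∑-upTo-suc n g) ⟩
    ∑ (upTo (suc n)) g ∎

  ∑-upTo-vanish : (n : ℕ) (f : ℕ → Carrier) → (∀ i → i < n → f i ≈ 0#) → ∑ (upTo n) f ≈ 0#
  ∑-upTo-vanish n f e = trans (∑-upTo-cong n e) (∑-0 (upTo n))

  ∑-upTo-+ : (a b : ℕ) (f : ℕ → Carrier) → ∑ (upTo (a ℕ.+ b)) f ≈ ∑ (upTo a) f + ∑ (upTo b) (λ i → f (a ℕ.+ i))
  ∑-upTo-+ a zero f = begin
    ∑ (upTo (a ℕ.+ 0)) f ≡⟨ P.cong (λ k → ∑ (upTo k) f) (ℕₚ.+-identityʳ a) ⟩
    ∑ (upTo a) f         ≈⟨ sym (+-identityʳ _) ⟩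
    ∑ (upTo a) f + 0#    ∎
  ∑-upTo-+ a (suc b) f = begin
    ∑ (upTo (a ℕ.+ suc b)) f                                      ≡⟨ P.cong (λ k → ∑ (upTo k) f) (ℕₚ.+-suc a b) ⟩
    ∑ (upTo (suc (a ℕ.+ b))) f                                    ≈⟨ ∑-upTo-suc (a ℕ.+ b) f ⟩
    ∑ (upTo (a ℕ.+ b)) f + f (a ℕ.+ b)                            ≈⟨ +-congʳ (∑-upTo-+ a b f) ⟩
    (∑ (upTo a) f + ∑ (upTo b) (λ i → f (a ℕ.+ i))) + f (a ℕ.+ b) ≈⟨ +-assoc _ _ _ ⟩
    ∑ (upTo a) f + (∑ (upTo b) (λ i → f (a ℕ.+ i)) + f (a ℕ.+ b)) ≈⟨ +-congˡ (sym (∑-upTo-suc b _)) ⟩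
    ∑ (upTo a) f + ∑ (upTo (suc b)) (λ i → f (a ℕ.+ i))           ∎

  ∑-upTo-truncate : (k N : ℕ) (f : ℕ → Carrier) → k ≤ N → (∀ i → k ≤ i → f i ≈ 0#) → ∑ (upTo N) f ≈ ∑ (upTo k) f
  ∑-upTo-truncate k N f k≤N e = begin
    ∑ (upTo N) f                                            ≡⟨ P.cong (λ x → ∑ (upTo x) f) (P.sym (ℕₚ.m+[n∸m]≡n k≤N)) ⟩
    ∑ (upTo (k ℕ.+ (N ℕ.∸ k))) f                            ≈⟨ ∑-upTo-+ k (N ℕ.∸ k) f ⟩
    ∑ (upTo k) f + ∑ (upTo (N ℕ.∸ k)) (λ i → f (k ℕ.+ i))   ≈⟨ +-congˡ (∑-upTo-vanish (N ℕ.∸ k) _ (λ i _ → e (k ℕ.+ i) (ℕₚ.m≤m+n k i))) ⟩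
    ∑ (upTo k) f + 0#                                       ≈⟨ +-identityʳ _ ⟩
    ∑ (upTo k) f                                            ∎

  ∑-upTo-single : (n k : ℕ) (f : ℕ → Carrier) → k < n → (∀ i → i < n → ¬ i ≡ k → f i ≈ 0#) → ∑ (upTo n) f ≈ f k
  ∑-upTo-single zero k f () e
  ∑-upTo-single (suc n) k f k<1+n e with ℕₚ.m≤n⇒m<n∨m≡n (ℕₚ.≤-pred k<1+n)
  ... | inj₁ k<n = begin
    ∑ (upTo (suc n)) f ≈⟨ ∑-upTo-suc n f ⟩
    ∑ (upTo n) f + f n ≈⟨ +-cong (∑-upTo-single n k f k<n (λ i i<n → e i (ℕₚ.m<n⇒m<1+n i<n)))
                                 (e n ℕₚ.≤-refl (λ n≡k → ℕₚ.<-irrefl (P.sym n≡k) k<n)) ⟩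
    f k + 0#           ≈⟨ +-identityʳ _ ⟩
    f k                ∎
  ... | inj₂ P.refl = begin
    ∑ (upTo (suc n)) f ≈⟨ ∑-upTo-suc n f ⟩
    ∑ (upTo n) f + f n ≈⟨ +-congʳ (∑-upTo-vanish n f (λ i i<n → e i (ℕₚ.m<n⇒m<1+n i<n) (ℕₚ.<⇒≢ i<n))) ⟩
    0# + f n           ≈⟨ +-identityˡ _ ⟩
    f n                ∎

  ∑-upTo-blocks : (q N : ℕ) (f : ℕ → Carrier) → ∑ (upTo (q ℕ.* N)) f ≈ ∑ (upTo q) (λ t → ∑ (upTo N) (λ j → f (t ℕ.* N ℕ.+ j)))
  ∑-upTo-blocks zero N f = refl
  ∑-upTo-blocks (suc q) N f = begin
    ∑ (upTo (N ℕ.+ q ℕ.* N)) f                         ≡⟨ P.cong (λ x → ∑ (upTo x) f) (ℕₚ.+-comm N (q ℕ.* N)) ⟩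
    ∑ (upTo (q ℕ.* N ℕ.+ N)) f                         ≈⟨ ∑-upTo-+ (q ℕ.* N) N f ⟩
    ∑ (upTo (q ℕ.* N)) f + block q                     ≈⟨ +-congʳ (∑-upTo-blocks q N f) ⟩
    ∑ (upTo q) block + block q                         ≈⟨ sym (∑-upTo-suc q block) ⟩
    ∑ (upTo (suc q)) block                             ∎
    where
    block : ℕ → Carrier
    block t = ∑ (upTo N) (λ j → f (t ℕ.* N ℕ.+ j))

  ∑-upTo-shift : (n : ℕ) (h : ℕ → Carrier) → h n ≈ h 0 → ∑ (upTo n) (λ i → h (suc i)) ≈ ∑ (upTo n) h
  ∑-upTo-shift zero h e = refl
  ∑-upTo-shift (suc n) h e = begin
    ∑ (upTo (suc n)) (λ i → h (suc i))             ≈⟨ ∑-upTo-suc n (λ i → h (suc i)) ⟩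
    ∑ (upTo n) (λ i → h (suc i)) + h (suc n)       ≈⟨ +-comm _ _ ⟩
    h (suc n) + ∑ (upTo n) (λ i → h (suc i))       ≈⟨ +-congʳ e ⟩
    h 0 + ∑ (upTo n) (λ i → h (suc i))             ≡⟨ P.cong (λ s → h 0 + s) (P.sym (∑-map (upTo n) suc h)) ⟩
    h 0 + ∑ (map suc (upTo n)) h                   ≡⟨ P.cong (λ l → h 0 + ∑ l h) (Listₚ.map-upTo suc n) ⟩
    ∑ (upTo (suc n)) h                             ∎

  ∑-range1 : (n : ℕ) (f : ℕ → Carrier) → ∑ (range1 n) f ≡ ∑ (upTo n) (λ i → f (suc i))
  ∑-range1 n f = ∑-map (upTo n) suc f

  ∑-multiples : (e q : ℕ) → 1 ≤ e → (f : ℕ → Carrier) →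
                ∑ (upTo (q ℕ.* e)) (λ i → ind (e ∣? suc i) * f (suc i)) ≈ ∑ (upTo q) (λ t → f (e ℕ.* suc t))
  ∑-multiples e q 1≤e f = begin
    ∑ (upTo (q ℕ.* e)) g                                   ≈⟨ ∑-upTo-blocks q e g ⟩
    ∑ (upTo q) (λ t → ∑ (upTo e) (λ j → g (t ℕ.* e ℕ.+ j)))
      ≈⟨ ∑-upTo-cong q (λ t _ → ∑-upTo-single e (e ℕ.∸ 1) _ e∸1<e (λ j j<e j≢ → off-multiple t j j<e j≢)) ⟩
    ∑ (upTo q) (λ t → g (t ℕ.* e ℕ.+ (e ℕ.∸ 1)))          ≈⟨ ∑-upTo-cong q (λ t _ → on-multiple t) ⟩
    ∑ (upTo q) (λ t → f (e ℕ.* suc t))                     ∎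
    where
    instance _ = ℕ.>-nonZero 1≤e
    g : ℕ → Carrier
    g i = ind (e ∣? suc i) * f (suc i)
    e∸1<e : e ℕ.∸ 1 < e
    e∸1<e = ℕₚ.∸-monoʳ-< {o = 0} (s≤s z≤n) 1≤e
    last : ∀ t → suc (t ℕ.* e ℕ.+ (e ℕ.∸ 1)) ≡ e ℕ.* suc t
    last t = P.trans (P.sym (ℕₚ.+-suc (t ℕ.* e) (e ℕ.∸ 1)))
             (P.trans (P.cong (t ℕ.* e ℕ.+_) (ℕₚ.m+[n∸m]≡n 1≤e))
             (P.trans (ℕₚ.+-comm (t ℕ.* e) e) (ℕₚ.*-comm (suc t) e)))
    on-multiple : ∀ t → g (t ℕ.* e ℕ.+ (e ℕ.∸ 1)) ≈ f (e ℕ.* suc t)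
    on-multiple t rewrite last t = trans (*-congʳ (ind-yes (e ∣? e ℕ.* suc t) (∣m⇒∣m*n (suc t) ∣-refl))) (*-identityˡ _)
    off-multiple : ∀ t j → j < e → ¬ j ≡ e ℕ.∸ 1 → g (t ℕ.* e ℕ.+ j) ≈ 0#
    off-multiple t j j<e j≢ = trans (*-congʳ (ind-no (e ∣? suc (t ℕ.* e ℕ.+ j)) e∤)) (zeroˡ _)
      where
      e∤ : ¬ e ∣ suc (t ℕ.* e ℕ.+ j)
      e∤ e∣ with ℕₚ.m≤n⇒m<n∨m≡n j<e
      ... | inj₂ 1+j≡e = j≢ (P.cong (ℕ._∸ 1) 1+j≡e)
      ... | inj₁ 1+j<e = ℕₚ.<⇒≱ 1+j<e (∣⇒≤ (∣m+n∣m⇒∣n (P.subst (e ∣_) (P.sym (ℕₚ.+-suc (t ℕ.* e) j)) e∣) (n∣m*n t)))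

  ∑-divisors : (n : ℕ) (f : ℕ → Carrier) → ∑ (divisors n) f ≈ ∑ (upTo n) (λ i → ind (suc i ∣? n) * f (suc i))
  ∑-divisors n f = trans (∑-filter (_∣? n) (range1 n) f) (reflexive (∑-range1 n (λ x → ind (x ∣? n) * f x)))

  ∑-divisors-cong : (n : ℕ) {f g : ℕ → Carrier} → (∀ d → d ∣ n → f d ≈ g d) → ∑ (divisors n) f ≈ ∑ (divisors n) g
  ∑-divisors-cong n {f} {g} e = begin
    ∑ (divisors n) f                                 ≈⟨ ∑-divisors n f ⟩
    ∑ (upTo n) (λ i → ind (suc i ∣? n) * f (suc i))  ≈⟨ ∑-cong (upTo n) term ⟩
    ∑ (upTo n) (λ i → ind (suc i ∣? n) * g (suc i))  ≈⟨ sym (∑-divisors n g) ⟩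
    ∑ (divisors n) g                                 ∎
    where
    term : ∀ i → ind (suc i ∣? n) * f (suc i) ≈ ind (suc i ∣? n) * g (suc i)
    term i with suc i ∣? n
    ... | yes d∣n = *-congˡ (e (suc i) d∣n)
    ... | no _ = trans (zeroˡ _) (sym (zeroˡ _))

  ∑-factorisations : ℕ → (ℕ → ℕ → Carrier) → Carrier
  ∑-factorisations n F = ∑ (upTo n) (λ a → ∑ (upTo n) (λ b → ind (suc a ℕ.* suc b ℕ.≟ n) * F (suc a) (suc b)))

  ∑-divisors-factorisations : (n : ℕ) (F : ℕ → ℕ → Carrier) → ∑ (divisors n) (λ e → F e (divN n e)) ≈ ∑-factorisations n F
  ∑-divisors-factorisations n F = trans (∑-divisors n _) (∑-upTo-cong n row)
    where
    -- for a fixed first factor a+1 there is at most one cofactor, namely n/(a+1)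
    row : ∀ a → a < n → ind (suc a ∣? n) * F (suc a) (divN n (suc a))
                        ≈ ∑ (upTo n) (λ b → ind (suc a ℕ.* suc b ℕ.≟ n) * F (suc a) (suc b))
    row a a<n with suc a ∣? n
    ... | no a∤n = trans (zeroˡ _) (sym (∑-upTo-vanish n _ (λ b _ → trans (*-congʳ (ind-no (suc a ℕ.* suc b ℕ.≟ n) no-cofactor)) (zeroˡ _))))
      where
      no-cofactor : ∀ {b} → ¬ suc a ℕ.* suc b ≡ n
      no-cofactor {b} ab≡n = a∤n (divides (suc b) (P.trans (P.sym ab≡n) (ℕₚ.*-comm (suc a) (suc b))))
    ... | yes (divides zero n≡0) = ⊥-elim (ℕₚ.<⇒≢ (ℕₚ.<-≤-trans (s≤s z≤n) a<n) (P.sym n≡0))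
    ... | yes (divides (suc k) n≡ka) = begin
      1# * F (suc a) (divN n (suc a))                     ≈⟨ *-identityˡ _ ⟩
      F (suc a) (divN n (suc a))                          ≡⟨ P.cong (F (suc a)) cofactor ⟩
      F (suc a) (suc k)                                   ≈⟨ sym (trans (*-congʳ (ind-yes (suc a ℕ.* suc k ℕ.≟ n) factorisation)) (*-identityˡ _)) ⟩
      ind (suc a ℕ.* suc k ℕ.≟ n) * F (suc a) (suc k)     ≈⟨ sym (∑-upTo-single n k _ k<n other) ⟩
      ∑ (upTo n) (λ b → ind (suc a ℕ.* suc b ℕ.≟ n) * F (suc a) (suc b)) ∎
      where
      factorisation : suc a ℕ.* suc k ≡ n
      factorisation = P.trans (ℕₚ.*-comm (suc a) (suc k)) (P.sym n≡ka)
      cofactor : divN n (suc a) ≡ suc k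
      cofactor = P.trans (P.cong (λ z → divN z (suc a)) n≡ka) (DM.m*n/n≡m (suc k) (suc a))
      k<n : k < n
      k<n = P.subst (suc k ≤_) (P.sym n≡ka) (ℕₚ.m≤m*n (suc k) (suc a))
      other : ∀ b → b < n → ¬ b ≡ k → ind (suc a ℕ.* suc b ℕ.≟ n) * F (suc a) (suc b) ≈ 0#
      other b _ b≢k = trans (*-congʳ (ind-no (suc a ℕ.* suc b ℕ.≟ n) (λ ab≡n → b≢k (ℕₚ.suc-injective
                        (ℕₚ.*-cancelˡ-≡ (suc b) (suc k) (suc a) (P.trans ab≡n (P.sym factorisation))))))) (zeroˡ _)

  ∑-divisors-flip : (n : ℕ) (F : ℕ → ℕ → Carrier) → ∑ (divisors n) (λ e → F e (divN n e)) ≈ ∑ (divisors n) (λ d → F (divN n d) d)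
  ∑-divisors-flip n F = begin
    ∑ (divisors n) (λ e → F e (divN n e)) ≈⟨ ∑-divisors-factorisations n F ⟩
    ∑-factorisations n F                  ≈⟨ ∑-swap (upTo n) (upTo n) _ ⟩
    ∑ (upTo n) (λ b → ∑ (upTo n) (λ a → ind (suc a ℕ.* suc b ℕ.≟ n) * F (suc a) (suc b)))
      ≈⟨ ∑-cong (upTo n) (λ b → ∑-cong (upTo n) (λ a → *-congʳ (ind-cong (suc a ℕ.* suc b ℕ.≟ n) (suc b ℕ.* suc a ℕ.≟ n) (P.trans (ℕₚ.*-comm (suc b) (suc a)))
                                                                            (P.trans (ℕₚ.*-comm (suc a) (suc b)))))) ⟩
    ∑-factorisations n (λ x y → F y x)    ≈⟨ sym (∑-divisors-factorisations n (λ x y → F y x)) ⟩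
    ∑ (divisors n) (λ d → F (divN n d) d) ∎

module Z = Sum ℤₚ.+-*-commutativeRing

-- The canonical ring homomorphism ℤ → R (embedℤ from Defs); it transports the
-- integer identity of the theorem into R.
module Embedding {c ℓ : Level} (R : CommutativeRing c ℓ) where
  open CommutativeRing R
  open import Relation.Binary.Reasoning.Setoid setoid
  open Sum R
  import Algebra.Properties.Group +-group as +-Group
  import Algebra.Properties.AbelianGroup +-abelianGroup as +-AbelianGroup
  import Algebra.Properties.Ring ring as RingProperties

  N : ℕ → Carrier
  N = natR R

  E : ℤ → Carrier
  E = embedℤ R

  N-+ : ∀ m n → N (m ℕ.+ n) ≈ N m + N n
  N-+ zero n = sym (+-identityˡ _)
  N-+ (suc m) n = trans (+-congˡ (N-+ m n)) (sym (+-assoc _ _ _))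

  N-∸ : ∀ {m n} → n ≤ m → N (m ℕ.∸ n) ≈ N m - N n
  N-∸ {m} {n} n≤m = begin
    N (m ℕ.∸ n)                   ≈⟨ sym (+-AbelianGroup.xyx⁻¹≈y (N n) _) ⟩
    (N n + N (m ℕ.∸ n)) - N n     ≈⟨ +-congʳ (sym (N-+ n (m ℕ.∸ n))) ⟩
    N (n ℕ.+ (m ℕ.∸ n)) - N n     ≡⟨ P.cong (λ k → N k - N n) (ℕₚ.m+[n∸m]≡n n≤m) ⟩
    N m - N n                     ∎

  E-neg : ∀ x → E (ℤ.- x) ≈ - E x
  E-neg (+ zero) = sym +-Group.ε⁻¹≈ε
  E-neg (+ suc n) = refl
  E-neg -[1+ n ] = sym (+-Group.⁻¹-involutive _)

  E-⊖ : ∀ m n → E (m ℤ.⊖ n) ≈ N m - N n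
  E-⊖ m n with ℕₚ.≤-total n m
  ... | inj₁ n≤m = trans (reflexive (P.cong E (ℤₚ.⊖-≥ n≤m))) (N-∸ n≤m)
  ... | inj₂ m≤n = begin
    E (m ℤ.⊖ n)              ≡⟨ P.cong E (ℤₚ.⊖-≤ m≤n) ⟩
    E (ℤ.- + (n ℕ.∸ m))      ≈⟨ E-neg (+ (n ℕ.∸ m)) ⟩
    - N (n ℕ.∸ m)            ≈⟨ -‿cong (N-∸ m≤n) ⟩
    - (N n - N m)            ≈⟨ +-AbelianGroup.⁻¹-anti-homo‿- (N n) (N m) ⟩
    N m - N n                ∎

  E-+ : ∀ x y → E (x ℤ.+ y) ≈ E x + E y
  E-+ -[1+ m ] -[1+ n ] = begin
    - (1# + N (suc (m ℕ.+ n)))   ≡⟨ P.cong (λ k → - (1# + N k)) (P.sym (ℕₚ.+-suc m n)) ⟩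
    - N (suc m ℕ.+ suc n)        ≈⟨ -‿cong (N-+ (suc m) (suc n)) ⟩
    - (N (suc m) + N (suc n))    ≈⟨ sym (+-AbelianGroup.⁻¹-∙-comm _ _) ⟩
    - N (suc m) + - N (suc n)    ∎
  E-+ -[1+ m ] (+ n) = trans (E-⊖ n (suc m)) (+-comm _ _)
  E-+ (+ m) -[1+ n ] = E-⊖ m (suc n)
  E-+ (+ m) (+ n) = N-+ m n

  E-+* : ∀ n y → E (+ n ℤ.* y) ≈ N n * E y
  E-+* zero y = trans (reflexive (P.cong E (ℤₚ.*-zeroˡ y))) (sym (zeroˡ _))
  E-+* (suc n) y = begin
    E (+ suc n ℤ.* y)                ≡⟨ P.cong E (ℤₚ.*-distribʳ-+ y (+ 1) (+ n)) ⟩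
    E (+ 1 ℤ.* y ℤ.+ + n ℤ.* y)      ≈⟨ E-+ (+ 1 ℤ.* y) (+ n ℤ.* y) ⟩
    E (+ 1 ℤ.* y) + E (+ n ℤ.* y)    ≡⟨ P.cong (λ k → E k + E (+ n ℤ.* y)) (ℤₚ.*-identityˡ y) ⟩
    E y + E (+ n ℤ.* y)              ≈⟨ +-cong (sym (*-identityˡ _)) (E-+* n y) ⟩
    1# * E y + N n * E y             ≈⟨ sym (distribʳ _ _ _) ⟩
    (1# + N n) * E y                 ∎

  E-* : ∀ x y → E (x ℤ.* y) ≈ E x * E y
  E-* (+ n) y = E-+* n y
  E-* -[1+ n ] y = begin
    E (-[1+ n ] ℤ.* y)           ≡⟨ P.cong E (P.sym (ℤₚ.neg-distribˡ-* (+ suc n) y)) ⟩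
    E (ℤ.- (+ suc n ℤ.* y))      ≈⟨ E-neg (+ suc n ℤ.* y) ⟩
    - E (+ suc n ℤ.* y)          ≈⟨ -‿cong (E-+* (suc n) y) ⟩
    - (N (suc n) * E y)          ≈⟨ RingProperties.-‿distribˡ-* _ _ ⟩
    - N (suc n) * E y            ∎

  E-1 : E 1ℤ ≈ 1#
  E-1 = +-identityʳ _

  E-∑ : (xs : List A) (f : A → ℤ) → E (Z.∑ xs f) ≈ ∑ xs (E ∘ f)
  E-∑ [] f = refl
  E-∑ (x ∷ xs) f = trans (E-+ (f x) (Z.∑ xs f)) (+-congˡ (E-∑ xs f))

  E-ind : {P : Set ℓ₃} (d : Dec P) → E (Z.ind d) ≈ ind d
  E-ind (yes _) = E-1
  E-ind (no _) = refl

  E-prod : ∀ {r} (f : Fin r → ℤ) → E (prodFinℤ f) ≈ prodFinR R (E ∘ f)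
  E-prod {zero} f = E-1
  E-prod {suc r} f = trans (E-* (f fzero) _) (*-congˡ (E-prod (f ∘ fsuc)))

natR-ℤ : ∀ n → natR ℤₚ.+-*-commutativeRing n ≡ + n
natR-ℤ zero = P.refl
natR-ℤ (suc n) = P.cong (1ℤ +ℤ_) (natR-ℤ n)

embedℤ-ℤ : ∀ x → embedℤ ℤₚ.+-*-commutativeRing x ≡ x
embedℤ-ℤ (+ n) = natR-ℤ n
embedℤ-ℤ -[1+ n ] = P.cong ℤ.-_ (natR-ℤ (suc n))

length-filter-ℤ : {P : Pred A ℓ₃} (P? : Decidable P) (xs : List A) → + length (filter P? xs) ≡ Z.∑ xs (λ x → Z.ind (P? x))
length-filter-ℤ P? xs = P.trans (P.sym (natR-ℤ (length (filter P? xs)))) (Z.length-filter P? xs)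

module Residues where
  open P using (cong; sym; trans; subst; subst₂)
  open P.≡-Reasoning

  divN-exact : ∀ {n} q e → 1 ≤ e → n ≡ q ℕ.* e → divN n e ≡ q
  divN-exact q (suc e) _ P.refl = DM.m*n/n≡m q (suc e)

  divN≡/ : ∀ a b .{{_ : NonZero b}} → divN a b ≡ a / b
  divN≡/ a (suc b) = P.refl

  factors-pos : ∀ {n} q e → 1 ≤ n → n ≡ q ℕ.* e → 1 ≤ q × 1 ≤ e
  factors-pos zero e () P.refl
  factors-pos (suc q) zero 1≤n eq = ⊥-elim (ℕₚ.<⇒≢ 1≤n (sym (trans eq (ℕₚ.*-zeroʳ (suc q)))))
  factors-pos (suc q) (suc e) _ _ = s≤s z≤n , s≤s z≤n

  divisor-pos : ∀ {d n} → d ∣ n → 1 ≤ n → 1 ≤ d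
  divisor-pos {zero} 0∣n 1≤n = ⊥-elim (ℕₚ.<⇒≢ 1≤n (sym (0∣⇒≡0 0∣n)))
  divisor-pos {suc d} _ _ = s≤s z≤n

  infix 4 _≡_[mod_]
  record _≡_[mod_] (x y : ℤ) (n : ℕ) : Set where
    constructor by
    field
      factor : ℤ
      equation : x ≡ y +ℤ factor *ℤ + n

  ≡-mod-refl : ∀ {x n} → x ≡ x [mod n ]
  ≡-mod-refl {x} {n} = by 0ℤ (zero-multiple x (+ n))
    where
    zero-multiple : ∀ (x n : ℤ) → x ≡ x +ℤ 0ℤ *ℤ n
    zero-multiple = solve-∀

  ≡-mod-sym : ∀ {x y n} → x ≡ y [mod n ] → y ≡ x [mod n ]
  ≡-mod-sym {x} {y} {n} (by z eq) = by (ℤ.- z) (trans (flip y z (+ n)) (cong (λ w → w +ℤ ℤ.- z *ℤ + n) (sym eq)))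
    where
    flip : ∀ (y z n : ℤ) → y ≡ (y +ℤ z *ℤ n) +ℤ ℤ.- z *ℤ n
    flip = solve-∀

  ≡-mod-trans : ∀ {x y w n} → x ≡ y [mod n ] → y ≡ w [mod n ] → x ≡ w [mod n ]
  ≡-mod-trans {w = w} {n = n} (by z x≡) (by z′ y≡) = by (z′ +ℤ z) (trans x≡ (trans (cong (λ v → v +ℤ z *ℤ + n) y≡) (regroup w z′ z (+ n))))
    where
    regroup : ∀ (w z′ z n : ℤ) → (w +ℤ z′ *ℤ n) +ℤ z *ℤ n ≡ w +ℤ (z′ +ℤ z) *ℤ n
    regroup = solve-∀

  ≡-mod-+ : ∀ {x x′ y y′ n} → x ≡ x′ [mod n ] → y ≡ y′ [mod n ] → x +ℤ y ≡ x′ +ℤ y′ [mod n ]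
  ≡-mod-+ {x′ = x′} {y′ = y′} {n} (by z P.refl) (by w P.refl) = by (z +ℤ w) (regroup x′ y′ z w (+ n))
    where
    regroup : ∀ (x y z w n : ℤ) → (x +ℤ z *ℤ n) +ℤ (y +ℤ w *ℤ n) ≡ (x +ℤ y) +ℤ (z +ℤ w) *ℤ n
    regroup = solve-∀

  ≡-mod-* : ∀ {x x′ y y′ n} → x ≡ x′ [mod n ] → y ≡ y′ [mod n ] → x *ℤ y ≡ x′ *ℤ y′ [mod n ]
  ≡-mod-* {x′ = x′} {y′ = y′} {n} (by z P.refl) (by w P.refl) = by (z *ℤ y′ +ℤ x′ *ℤ w +ℤ z *ℤ w *ℤ + n) (expand x′ y′ z w (+ n))
    where
    expand : ∀ (x y z w n : ℤ) → (x +ℤ z *ℤ n) *ℤ (y +ℤ w *ℤ n) ≡ x *ℤ y +ℤ (z *ℤ y +ℤ x *ℤ w +ℤ z *ℤ w *ℤ n) *ℤ n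
    expand = solve-∀

  ≡-mod-scale : ∀ k {x y q} → x ≡ y [mod q ] → + k *ℤ x ≡ + k *ℤ y [mod k ℕ.* q ]
  ≡-mod-scale k {y = y} {q} (by z P.refl) = by z (trans (distrib (+ k) y z (+ q)) (cong (λ m → + k *ℤ y +ℤ z *ℤ m) (sym (ℤₚ.pos-* k q))))
    where
    distrib : ∀ (k y z q : ℤ) → k *ℤ (y +ℤ z *ℤ q) ≡ k *ℤ y +ℤ z *ℤ (k *ℤ q)
    distrib = solve-∀

  ≡-mod-divisor : ∀ {x y n d} → d ∣ n → x ≡ y [mod n ] → x ≡ y [mod d ]
  ≡-mod-divisor {y = y} {d = d} (divides c P.refl) (by z P.refl) =
    by (z *ℤ + c) (trans (cong (λ m → y +ℤ z *ℤ m) (ℤₚ.pos-* c d)) (reassociate y z (+ c) (+ d)))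
    where
    reassociate : ∀ (y z c d : ℤ) → y +ℤ z *ℤ (c *ℤ d) ≡ y +ℤ (z *ℤ c) *ℤ d
    reassociate = solve-∀

  ≡-mod-setoid : ℕ → Setoid _ _
  ≡-mod-setoid n = record
    { Carrier = ℤ
    ; _≈_ = λ x y → x ≡ y [mod n ]
    ; isEquivalence = record { refl = ≡-mod-refl ; sym = ≡-mod-sym ; trans = ≡-mod-trans }
    }
  module ≡-mod-Reasoning (n : ℕ) = SetoidReasoning (≡-mod-setoid n)

  pos-+* : ∀ b k d → + (b ℕ.+ k ℕ.* d) ≡ + b +ℤ + k *ℤ + d
  pos-+* b k d = trans (ℤₚ.pos-+ b (k ℕ.* d)) (cong (+ b +ℤ_) (ℤₚ.pos-* k d))

  ≡-mod⇒% : ∀ {a b n} .{{_ : NonZero n}} → + a ≡ + b [mod n ] → a % n ≡ b % n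
  ≡-mod⇒% {a} {b} {n} (by (+ k) eq) = begin
    a % n               ≡⟨ cong (_% n) (ℤₚ.+-injective (trans eq (sym (pos-+* b k n)))) ⟩
    (b ℕ.+ k ℕ.* n) % n ≡⟨ DM.[m+kn]%n≡m%n b k n ⟩
    b % n               ∎
  ≡-mod⇒% {a} {b} {n} a≡b@(by -[1+ k ] _) = sym (begin
    b % n                   ≡⟨ cong (_% n) (ℤₚ.+-injective (trans (_≡_[mod_].equation (≡-mod-sym a≡b)) (sym (pos-+* a (suc k) n)))) ⟩
    (a ℕ.+ suc k ℕ.* n) % n ≡⟨ DM.[m+kn]%n≡m%n a (suc k) n ⟩
    a % n                   ∎)

  ≡-mod-unique : ∀ {a b n} .{{_ : NonZero n}} → + a ≡ + b [mod n ] → a < n → b < n → a ≡ b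
  ≡-mod-unique a≡b a<n b<n = trans (sym (DM.m<n⇒m%n≡m a<n)) (trans (≡-mod⇒% a≡b) (DM.m<n⇒m%n≡m b<n))

  modN-≡ : ∀ (y : ℤ) n .{{_ : NonZero n}} → y ≡ + modN y n [mod n ]
  modN-≡ y (suc n) = by (y ℤDM./ℕ suc n) (ℤDM.a≡a%ℕn+[a/ℕn]*n y (suc n))

  modN< : ∀ (y : ℤ) n .{{_ : NonZero n}} → modN y n < n
  modN< y (suc n) = ℤDM.n%ℕd<d y (suc n)

  modN-+ : ∀ a n .{{_ : NonZero n}} → modN (+ a) n ≡ a % n
  modN-+ a (suc n) = P.refl

  %-≡-mod : ∀ a n .{{_ : NonZero n}} → + a ≡ + (a % n) [mod n ]
  %-≡-mod a n = subst (λ r → + a ≡ + r [mod n ]) (modN-+ a n) (modN-≡ (+ a) n)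

  ≡-mod-scaled-residue : ∀ e s (x : ℤ) q .{{_ : NonZero q}} → + (e ℕ.* s) *ℤ x ≡ + (e ℕ.* (s ℕ.* modN x q)) [mod e ℕ.* q ]
  ≡-mod-scaled-residue e s x q = subst₂ (λ u v → u ≡ v [mod e ℕ.* q ]) lhs rhs (≡-mod-* (≡-mod-refl {+ s}) (≡-mod-scale e (modN-≡ x q)))
    where
    r : ℕ
    r = modN x q
    reassociate : ∀ (a b c : ℤ) → b *ℤ (a *ℤ c) ≡ (a *ℤ b) *ℤ c
    reassociate = solve-∀
    commute : ∀ (a b c : ℤ) → b *ℤ (a *ℤ c) ≡ a *ℤ (b *ℤ c)
    commute = solve-∀
    lhs : + s *ℤ (+ e *ℤ x) ≡ + (e ℕ.* s) *ℤ x
    lhs = trans (reassociate (+ e) (+ s) x) (cong (_*ℤ x) (sym (ℤₚ.pos-* e s)))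
    rhs : + s *ℤ (+ e *ℤ + r) ≡ + (e ℕ.* (s ℕ.* r))
    rhs = trans (commute (+ e) (+ s) (+ r)) (trans (cong (+ e *ℤ_) (sym (ℤₚ.pos-* s r))) (sym (ℤₚ.pos-* e (s ℕ.* r))))

  ≡-mod-∣ : ∀ {x y d} → x ≡ y [mod d ] → d ∣ ∣ x ∣ → d ∣ ∣ y ∣
  ≡-mod-∣ {x} {y} {d} (by z P.refl) d∣x =
    ℤ∣ₛ.∣⇒∣ᵤ {+ d} {y} (ℤ∣ₛ.∣m+n∣n⇒∣m (ℤ∣ₛ.∣ᵤ⇒∣ {+ d} {y +ℤ z *ℤ + d} d∣x) (ℤ∣ₛ.∣n⇒∣m*n z (ℤ∣ₛ.∣-refl {+ d})))

  modN≡0⇒∣ : ∀ (x : ℤ) n .{{_ : NonZero n}} → modN x n ≡ 0 → n ∣ ∣ x ∣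
  modN≡0⇒∣ x n r≡0 = ≡-mod-∣ (≡-mod-sym (modN-≡ x n)) (subst (λ r → n ∣ ∣ + r ∣) (sym r≡0) (n ∣0))

  ∣⇒modN≡0 : ∀ (x : ℤ) n .{{_ : NonZero n}} → n ∣ ∣ x ∣ → modN x n ≡ 0
  ∣⇒modN≡0 x n n∣x = small-multiple (modN< x n) (≡-mod-∣ (modN-≡ x n) n∣x)
    where
    small-multiple : ∀ {r} → r < n → n ∣ r → r ≡ 0
    small-multiple {zero} _ _ = P.refl
    small-multiple {suc r} r<n n∣r = ⊥-elim (>⇒∤ r<n n∣r)

  coprime⇒inverse : ∀ {e L} → Coprime e L → Σ[ A ∈ ℤ ] (A *ℤ + e ≡ 1ℤ [mod L ])
  coprime⇒inverse {e} {L} e⊥L with coprime-Bézout e⊥L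
  ... | Bézout.+- x y eq = + x , by (+ y) (trans (sym (ℤₚ.pos-* x e)) (trans (cong +_ (sym eq)) (pos-+* 1 y L)))
  ... | Bézout.-+ x y eq = ℤ.- + x , by (ℤ.- + y) (trans (negate (+ x) (+ e)) (trans (cong (1ℤ -ℤ_) eq′) (negate′ (+ y) (+ L))))
    where
    eq′ : 1ℤ +ℤ + x *ℤ + e ≡ + y *ℤ + L
    eq′ = trans (sym (pos-+* 1 x e)) (trans (cong +_ eq) (ℤₚ.pos-* y L))
    negate : ∀ (x e : ℤ) → ℤ.- x *ℤ e ≡ 1ℤ -ℤ (1ℤ +ℤ x *ℤ e)
    negate = solve-∀
    negate′ : ∀ (y L : ℤ) → 1ℤ -ℤ y *ℤ L ≡ 1ℤ +ℤ ℤ.- y *ℤ L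
    negate′ = solve-∀

module Möbius where
  open P using (cong; cong₂; sym; trans)
  open P.≡-Reasoning

  squareDivisors : ℕ → List ℕ
  squareDivisors n = filter (λ d → (d ℕ.* d) ∣? n) (map (2 ℕ.+_) (upTo n))

  primeDivisorCount : ℕ → ℕ
  primeDivisorCount n = length (filter (λ p → prime? p ×-dec (p ∣? n)) (range1 n))

  HasSquareFactor : ℕ → Set
  HasSquareFactor n = Σ[ d ∈ ℕ ] (2 ≤ d × d ℕ.* d ∣ n)

  prime≥2 : ∀ {p} → Prime p → 2 ≤ p
  prime≥2 {p} pp = ℕ.nonTrivial⇒n>1 p {{prime⇒nonTrivial pp}}

  prime-coprime : ∀ {p m} → Prime p → ¬ p ∣ m → Coprime m p
  prime-coprime pp p∤m (c∣m , c∣p) with prime⇒irreducible pp c∣p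
  ... | inj₁ c≡1 = c≡1
  ... | inj₂ P.refl = ⊥-elim (p∤m c∣m)

  -- a square factor d² of n ≥ 1 with d ≥ 2 satisfies d ≤ n, so it is found by the search in Defs
  square-factor⇒count : ∀ {n} → 1 ≤ n → HasSquareFactor n → Σ[ k ∈ ℕ ] length (squareDivisors n) ≡ suc k
  square-factor⇒count {n} 1≤n (d , 2≤d , dd∣n) = nonempty (∈-filter⁺ _ (∈-map⁺ (2 ℕ.+_) (∈-upTo⁺ d∸2<n)) dd∣n′)
    where
    instance _ = ℕ.>-nonZero 1≤n
    d≤n : d ≤ n
    d≤n = ℕₚ.≤-trans (ℕₚ.m≤m*n d d {{ℕ.>-nonZero (ℕₚ.≤-trans (s≤s z≤n) 2≤d)}}) (∣⇒≤ dd∣n)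
    d∸2<n : d ℕ.∸ 2 < n
    d∸2<n = ℕₚ.<-≤-trans (ℕₚ.∸-monoʳ-< {o = 0} (s≤s z≤n) 2≤d) d≤n
    dd∣n′ : (2 ℕ.+ (d ℕ.∸ 2)) ℕ.* (2 ℕ.+ (d ℕ.∸ 2)) ∣ n
    dd∣n′ = P.subst (λ e → e ℕ.* e ∣ n) (sym (ℕₚ.m+[n∸m]≡n 2≤d)) dd∣n
    nonempty : ∀ {x} {xs : List ℕ} → x ∈ xs → Σ[ k ∈ ℕ ] length xs ≡ suc k
    nonempty {xs = _ ∷ ys} _ = length ys , P.refl

  count⇒square-factor : ∀ {n k} → length (squareDivisors n) ≡ suc k → HasSquareFactor n
  count⇒square-factor {n} eq with squareDivisors n in eqs
  ... | d ∷ _ with ∈-filter⁻ (λ d → (d ℕ.* d) ∣? n) {xs = map (2 ℕ.+_) (upTo n)} (P.subst (d ∈_) (sym eqs) (here P.refl))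
  ...   | d∈range , dd∣n with ∈-map⁻ (2 ℕ.+_) d∈range
  ...     | i , _ , P.refl = 2 ℕ.+ i , ℕₚ.m≤m+n 2 i , dd∣n

  μ-squarefree : ∀ n → ¬ HasSquareFactor n → μ n ≡ -1ℤ ℤ.^ primeDivisorCount n
  μ-squarefree n sf with length (squareDivisors n) in eq
  ... | zero = P.refl
  ... | suc _ = ⊥-elim (sf (count⇒square-factor eq))

  μ-square : ∀ n → 1 ≤ n → HasSquareFactor n → μ n ≡ 0ℤ
  μ-square n 1≤n sq with length (squareDivisors n) in eq
  ... | suc _ = P.refl
  ... | zero = ⊥-elim (ℕₚ.0≢1+n (trans (sym eq) (proj₂ (square-factor⇒count 1≤n sq))))

  square-factor? : ∀ n → 1 ≤ n → Dec (HasSquareFactor n)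
  square-factor? n 1≤n with length (squareDivisors n) in eq
  ... | suc _ = yes (count⇒square-factor eq)
  ... | zero = no λ sq → ℕₚ.0≢1+n (trans (sym eq) (proj₂ (square-factor⇒count 1≤n sq)))

  square-factor-of-pk : ∀ {p k} → Prime p → ¬ p ∣ k → HasSquareFactor (p ℕ.* k) → HasSquareFactor k
  square-factor-of-pk {p} {k} pp p∤k (d , 2≤d , dd∣pk) with p ∣? d
  ... | yes p∣d = ⊥-elim (p∤k (*-cancelˡ-∣ p {{prime⇒nonZero pp}} (∣-trans (*-pres-∣ p∣d p∣d) dd∣pk)))
  ... | no p∤d = d , 2≤d , coprime-divisor (prime-coprime pp p∤dd) dd∣pk
    where
    p∤dd : ¬ p ∣ d ℕ.* d
    p∤dd p∣dd with euclidsLemma d d pp p∣dd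
    ... | inj₁ p∣d = p∤d p∣d
    ... | inj₂ p∣d = p∤d p∣d

  primeDivisorCount-∑ : ∀ n → + primeDivisorCount n ≡ Z.∑ (upTo n) (λ i → Z.ind (prime? (suc i) ×-dec (suc i ∣? n)))
  primeDivisorCount-∑ n = trans (length-filter-ℤ (λ p → prime? p ×-dec (p ∣? n)) (range1 n)) (Z.∑-range1 n _)

  -- the prime divisors of p k (p ∤ k) are p and the prime divisors of k
  primeDivisorCount-pk : ∀ p k → Prime p → ¬ p ∣ k → 1 ≤ k → primeDivisorCount (p ℕ.* k) ≡ suc (primeDivisorCount k)
  primeDivisorCount-pk p k pp p∤k 1≤k = ℤₚ.+-injective (begin
    + primeDivisorCount (p ℕ.* k)                        ≡⟨ primeDivisorCount-∑ (p ℕ.* k) ⟩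
    Z.∑ (upTo (p ℕ.* k)) (λ i → Z.ind (primeDiv? (p ℕ.* k) (suc i)))
      ≡⟨ Z.∑-upTo-cong (p ℕ.* k) (λ i _ → split (suc i)) ⟩
    Z.∑ (upTo (p ℕ.* k)) (λ i → Z.ind (suc i ℕ.≟ p) +ℤ Z.ind (primeDiv? k (suc i)))
      ≡⟨ Z.∑-+ (upTo (p ℕ.* k)) _ _ ⟩
    Z.∑ (upTo (p ℕ.* k)) (λ i → Z.ind (suc i ℕ.≟ p)) +ℤ Z.∑ (upTo (p ℕ.* k)) (λ i → Z.ind (primeDiv? k (suc i)))
      ≡⟨ cong₂ _+ℤ_ just-p (Z.∑-upTo-truncate k (p ℕ.* k) _ (ℕₚ.m≤n*m k p) beyond-k) ⟩
    1ℤ +ℤ Z.∑ (upTo k) (λ i → Z.ind (primeDiv? k (suc i))) ≡⟨ cong (1ℤ +ℤ_) (sym (primeDivisorCount-∑ k)) ⟩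
    + suc (primeDivisorCount k)                          ∎)
    where
    instance _ = prime⇒nonZero pp
    instance _ = ℕ.>-nonZero 1≤k
    primeDiv? : ∀ n s → Dec (Prime s × s ∣ n)
    primeDiv? n s = prime? s ×-dec (s ∣? n)
    split : ∀ s → Z.ind (primeDiv? (p ℕ.* k) s) ≡ Z.ind (s ℕ.≟ p) +ℤ Z.ind (primeDiv? k s)
    split s = Z.ind-⊎ (primeDiv? (p ℕ.* k) s) (s ℕ.≟ p) (primeDiv? k s) cases
                (λ { P.refl → pp , ∣m⇒∣m*n k ∣-refl }) (λ (ps , s∣k) → ps , ∣n⇒∣m*n p s∣k) (λ { P.refl (_ , p∣k) → p∤k p∣k })
      where
      cases : Prime s × s ∣ p ℕ.* k → s ≡ p ⊎ (Prime s × s ∣ k)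
      cases (ps , s∣pk) with euclidsLemma p k ps s∣pk
      ... | inj₂ s∣k = inj₂ (ps , s∣k)
      ... | inj₁ s∣p with prime⇒irreducible pp s∣p
      ...   | inj₁ P.refl = ⊥-elim (¬prime[1] ps)
      ...   | inj₂ s≡p = inj₁ s≡p
    beyond-k : ∀ i → k ≤ i → Z.ind (primeDiv? k (suc i)) ≡ 0ℤ
    beyond-k i k≤i = Z.ind-no (primeDiv? k (suc i)) (λ (_ , i+1∣k) → ℕₚ.<⇒≱ (s≤s k≤i) (∣⇒≤ i+1∣k))
    p∸1<pk : p ℕ.∸ 1 < p ℕ.* k
    p∸1<pk = ℕₚ.<-≤-trans (ℕₚ.∸-monoʳ-< {o = 0} (s≤s z≤n) (ℕₚ.≤-trans (s≤s z≤n) (prime≥2 pp))) (ℕₚ.m≤m*n p k)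
    just-p : Z.∑ (upTo (p ℕ.* k)) (λ i → Z.ind (suc i ℕ.≟ p)) ≡ 1ℤ
    just-p = trans (Z.∑-upTo-single (p ℕ.* k) (p ℕ.∸ 1) _ p∸1<pk (λ i _ i≢ → Z.ind-no (suc i ℕ.≟ p) (λ i+1≡p → i≢ (cong (ℕ._∸ 1) i+1≡p))))
                   (Z.ind-yes (suc (p ℕ.∸ 1) ℕ.≟ p) (ℕₚ.m+[n∸m]≡n (ℕₚ.≤-trans (s≤s z≤n) (prime≥2 pp))))

  1≤p*k : ∀ {p k} → Prime p → 1 ≤ k → 1 ≤ p ℕ.* k
  1≤p*k pp 1≤k = ℕₚ.*-mono-≤ (ℕₚ.≤-trans (s≤s z≤n) (prime≥2 pp)) 1≤k

  μ-prime-* : ∀ p k → Prime p → 1 ≤ k → μ (p ℕ.* k) ≡ ℤ.- (Z.ind (¬? (p ∣? k)) *ℤ μ k)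
  μ-prime-* p k pp 1≤k with p ∣? k | square-factor? k 1≤k
  ... | yes p∣k | _ = μ-square (p ℕ.* k) (1≤p*k pp 1≤k) (p , prime≥2 pp , *-monoʳ-∣ p p∣k)
  ... | no p∤k | yes (d , 2≤d , dd∣k) =
    trans (μ-square (p ℕ.* k) (1≤p*k pp 1≤k) (d , 2≤d , ∣n⇒∣m*n p dd∣k)) (cong (λ z → ℤ.- (1ℤ *ℤ z)) (sym (μ-square k 1≤k (d , 2≤d , dd∣k))))
  ... | no p∤k | no k-sf = begin
    μ (p ℕ.* k)                               ≡⟨ μ-squarefree (p ℕ.* k) (k-sf ∘ square-factor-of-pk pp p∤k) ⟩
    -1ℤ ℤ.^ primeDivisorCount (p ℕ.* k)       ≡⟨ cong (-1ℤ ℤ.^_) (primeDivisorCount-pk p k pp p∤k 1≤k) ⟩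
    -1ℤ *ℤ (-1ℤ ℤ.^ primeDivisorCount k)      ≡⟨ ℤₚ.-1*i≡-i _ ⟩
    ℤ.- (-1ℤ ℤ.^ primeDivisorCount k)         ≡⟨ cong ℤ.-_ (sym (trans (ℤₚ.*-identityˡ _) (μ-squarefree k k-sf))) ⟩
    ℤ.- (1ℤ *ℤ μ k)                           ∎

  prime-factor : ∀ n → 2 ≤ n → Σ[ p ∈ ℕ ] (Prime p × p ∣ n)
  prime-factor 1 (s≤s ())
  prime-factor n@(suc (suc _)) _ with factorise n
  ... | record { factors = [] ; isFactorisation = () }
  ... | record { factors = p ∷ ps ; isFactorisation = eq ; factorsPrime = pp ∷ _ } =
    p , pp , divides (product ps) (trans eq (ℕₚ.*-comm p (product ps)))

  -- For n = p q with p prime, the divisors of n divisible by p contribute to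
  -- Σ_{d ∣ n} μ(d) exactly the negative of those prime to p.
  module PrimeSplit (p q : ℕ) (pp : Prime p) (1≤q : 1 ≤ q) where
    instance
      _ = prime⇒nonZero pp
      _ = ℕ.>-nonZero 1≤q

    n : ℕ
    n = p ℕ.* q

    T : ℕ → ℤ
    T s = Z.ind (s ∣? n) *ℤ μ s

    H : ℕ → ℤ
    H s = Z.ind (¬? (p ∣? s)) *ℤ (Z.ind (s ∣? q) *ℤ μ s)

    X : ℤ
    X = Z.∑ (upTo q) (λ i → H (suc i))

    T-multiple : ∀ t → T (p ℕ.* suc t) ≡ ℤ.- H (suc t)
    T-multiple t = begin
      Z.ind (p ℕ.* suc t ∣? n) *ℤ μ (p ℕ.* suc t)
        ≡⟨ cong (_*ℤ μ (p ℕ.* suc t)) (Z.ind-cong (p ℕ.* suc t ∣? n) (suc t ∣? q) (*-cancelˡ-∣ p) (*-monoʳ-∣ p)) ⟩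
      Z.ind (suc t ∣? q) *ℤ μ (p ℕ.* suc t)                               ≡⟨ cong (Z.ind (suc t ∣? q) *ℤ_) (μ-prime-* p (suc t) pp (s≤s z≤n)) ⟩
      Z.ind (suc t ∣? q) *ℤ ℤ.- (Z.ind (¬? (p ∣? suc t)) *ℤ μ (suc t))   ≡⟨ rearrange (Z.ind (suc t ∣? q)) (Z.ind (¬? (p ∣? suc t))) (μ (suc t)) ⟩
      ℤ.- H (suc t)                                                       ∎
      where
      rearrange : ∀ (a b c : ℤ) → a *ℤ ℤ.- (b *ℤ c) ≡ ℤ.- (b *ℤ (a *ℤ c))
      rearrange = solve-∀

    divisible-by-p : Z.∑ (upTo n) (λ i → Z.ind (p ∣? suc i) *ℤ T (suc i)) ≡ ℤ.- X
    divisible-by-p = begin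
      Z.∑ (upTo n) (λ i → Z.ind (p ∣? suc i) *ℤ T (suc i))         ≡⟨ cong (λ k → Z.∑ (upTo k) (λ i → Z.ind (p ∣? suc i) *ℤ T (suc i))) (ℕₚ.*-comm p q) ⟩
      Z.∑ (upTo (q ℕ.* p)) (λ i → Z.ind (p ∣? suc i) *ℤ T (suc i)) ≡⟨ Z.∑-multiples p q (ℕₚ.≤-trans (s≤s z≤n) (prime≥2 pp)) T ⟩
      Z.∑ (upTo q) (λ t → T (p ℕ.* suc t))                         ≡⟨ Z.∑-upTo-cong q (λ t _ → T-multiple t) ⟩
      Z.∑ (upTo q) (λ t → ℤ.- H (suc t))                            ≡⟨ Z.∑-neg (upTo q) (λ t → H (suc t)) ⟩
      ℤ.- X                                                         ∎

    -- a divisor of n = p q prime to p divides q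
    prime-to-p-term : ∀ s → Z.ind (¬? (p ∣? s)) *ℤ T s ≡ H s
    prime-to-p-term s with p ∣? s
    ... | yes _ = P.refl
    ... | no p∤s = cong (λ z → 1ℤ *ℤ (z *ℤ μ s))
                     (Z.ind-cong (s ∣? n) (s ∣? q) (coprime-divisor (prime-coprime pp p∤s)) (∣n⇒∣m*n p))

    prime-to-p : Z.∑ (upTo n) (λ i → Z.ind (¬? (p ∣? suc i)) *ℤ T (suc i)) ≡ X
    prime-to-p = trans (Z.∑-upTo-cong n (λ i _ → prime-to-p-term (suc i)))
                       (Z.∑-upTo-truncate q n (λ i → H (suc i)) (ℕₚ.m≤n*m q p) beyond-q)
      where
      beyond-q : ∀ i → q ≤ i → H (suc i) ≡ 0ℤ
      beyond-q i q≤i = trans (cong (λ z → Z.ind (¬? (p ∣? suc i)) *ℤ (z *ℤ μ (suc i))) (Z.ind-no (suc i ∣? q) (λ h → ℕₚ.<⇒≱ (s≤s q≤i) (∣⇒≤ h))))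
                             (ℤₚ.*-zeroʳ (Z.ind (¬? (p ∣? suc i))))

    ∑-μ-divisors-vanishes : Z.∑ (divisors n) μ ≡ 0ℤ
    ∑-μ-divisors-vanishes = begin
      Z.∑ (divisors n) μ                       ≡⟨ Z.∑-divisors n μ ⟩
      Z.∑ (upTo n) (λ i → T (suc i))           ≡⟨ Z.∑-upTo-cong n (λ i _ → Z.ind-split (p ∣? suc i) (T (suc i))) ⟩
      Z.∑ (upTo n) (λ i → Z.ind (p ∣? suc i) *ℤ T (suc i) +ℤ Z.ind (¬? (p ∣? suc i)) *ℤ T (suc i))
        ≡⟨ Z.∑-+ (upTo n) (λ i → Z.ind (p ∣? suc i) *ℤ T (suc i)) (λ i → Z.ind (¬? (p ∣? suc i)) *ℤ T (suc i)) ⟩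
      Z.∑ (upTo n) (λ i → Z.ind (p ∣? suc i) *ℤ T (suc i)) +ℤ Z.∑ (upTo n) (λ i → Z.ind (¬? (p ∣? suc i)) *ℤ T (suc i))
        ≡⟨ cong₂ _+ℤ_ divisible-by-p prime-to-p ⟩
      ℤ.- X +ℤ X                               ≡⟨ ℤₚ.+-inverseˡ X ⟩
      0ℤ                                       ∎

  ∑-μ-divisors : ∀ n → 1 ≤ n → Z.∑ (divisors n) μ ≡ Z.ind (n ℕ.≟ 1)
  ∑-μ-divisors 1 _ = P.refl
  ∑-μ-divisors n@(suc (suc _)) _ with prime-factor n (s≤s (s≤s z≤n))
  ... | p , pp , divides q n≡qp = trans (cong (λ k → Z.∑ (divisors k) μ) n≡pq) (PrimeSplit.∑-μ-divisors-vanishes p q pp 1≤q)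
    where
    n≡pq : n ≡ p ℕ.* q
    n≡pq = trans n≡qp (ℕₚ.*-comm q p)
    1≤q : 1 ≤ q
    1≤q = proj₁ (Residues.factors-pos q p (s≤s z≤n) n≡qp)

module Sieve where
  open Möbius using (∑-μ-divisors)

  ind-coprime-ℤ : ∀ m j → 1 ≤ m → Z.∑ (divisors m) (λ e → μ e *ℤ Z.ind (e ∣? j)) ≡ Z.ind (gcd j m ℕ.≟ 1)
  ind-coprime-ℤ m j 1≤m = begin
    Z.∑ (divisors m) (λ e → μ e *ℤ Z.ind (e ∣? j))                              ≡⟨ Z.∑-divisors m _ ⟩
    Z.∑ (upTo m) (λ i → Z.ind (suc i ∣? m) *ℤ (μ (suc i) *ℤ Z.ind (suc i ∣? j))) ≡⟨ Z.∑-upTo-cong m (λ i _ → common-divisor (suc i)) ⟩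
    Z.∑ (upTo m) (λ i → Z.ind (suc i ∣? g) *ℤ μ (suc i))                       ≡⟨ Z.∑-upTo-truncate g m _ (gcd[m,n]≤n j m) beyond-g ⟩
    Z.∑ (upTo g) (λ i → Z.ind (suc i ∣? g) *ℤ μ (suc i))                       ≡⟨ P.sym (Z.∑-divisors g μ) ⟩
    Z.∑ (divisors g) μ                                                         ≡⟨ ∑-μ-divisors g 1≤g ⟩
    Z.ind (g ℕ.≟ 1)                                                            ∎
    where
    open P.≡-Reasoning
    g : ℕ
    g = gcd j m
    instance _ = ℕ.>-nonZero 1≤m
    1≤g : 1 ≤ g
    1≤g = ℕ.>-nonZero⁻¹ g {{ℕ.≢-nonZero (gcd[m,n]≢0 j m (inj₂ (ℕ.≢-nonZero⁻¹ m)))}}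
    -- the common divisors of j and m are the divisors of g
    common-divisor : ∀ s → Z.ind (s ∣? m) *ℤ (μ s *ℤ Z.ind (s ∣? j)) ≡ Z.ind (s ∣? g) *ℤ μ s
    common-divisor s = begin
      Z.ind (s ∣? m) *ℤ (μ s *ℤ Z.ind (s ∣? j))  ≡⟨ rearrange (Z.ind (s ∣? m)) (μ s) (Z.ind (s ∣? j)) ⟩
      (Z.ind (s ∣? m) *ℤ Z.ind (s ∣? j)) *ℤ μ s  ≡⟨ P.cong (_*ℤ μ s) (P.sym (Z.ind-× (s ∣? m) (s ∣? j))) ⟩
      Z.ind ((s ∣? m) ×-dec (s ∣? j)) *ℤ μ s     ≡⟨ P.cong (_*ℤ μ s) (Z.ind-cong ((s ∣? m) ×-dec (s ∣? j)) (s ∣? g)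
                                                     (λ (s∣m , s∣j) → gcd-greatest s∣j s∣m)
                                                     (λ s∣g → ∣-trans s∣g (gcd[m,n]∣n j m) , ∣-trans s∣g (gcd[m,n]∣m j m))) ⟩
      Z.ind (s ∣? g) *ℤ μ s                      ∎
      where
      rearrange : ∀ (a b c : ℤ) → a *ℤ (b *ℤ c) ≡ (a *ℤ c) *ℤ b
      rearrange = solve-∀
    beyond-g : ∀ i → g ≤ i → Z.ind (suc i ∣? g) *ℤ μ (suc i) ≡ 0ℤ
    beyond-g i g≤i = P.cong (_*ℤ μ (suc i)) (Z.ind-no (suc i ∣? g) (λ h → ℕₚ.<⇒≱ (s≤s g≤i) (∣⇒≤ {{ℕ.>-nonZero 1≤g}} h)))

  module _ {c ℓ : Level} (R : CommutativeRing c ℓ) where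
    open CommutativeRing R
    open import Relation.Binary.Reasoning.Setoid setoid
    open Sum R
    open Embedding R

    ind-coprime : ∀ m j → 1 ≤ m → ind (gcd j m ℕ.≟ 1) ≈ ∑ (divisors m) (λ e → E (μ e) * ind (e ∣? j))
    ind-coprime m j 1≤m = begin
      ind (gcd j m ℕ.≟ 1)                                  ≈⟨ sym (E-ind (gcd j m ℕ.≟ 1)) ⟩
      E (Z.ind (gcd j m ℕ.≟ 1))                            ≡⟨ P.cong E (P.sym (ind-coprime-ℤ m j 1≤m)) ⟩
      E (Z.∑ (divisors m) (λ e → μ e *ℤ Z.ind (e ∣? j)))   ≈⟨ E-∑ (divisors m) _ ⟩
      ∑ (divisors m) (λ e → E (μ e *ℤ Z.ind (e ∣? j)))     ≈⟨ ∑-cong (divisors m) (λ e → trans (E-* (μ e) _) (*-congˡ (E-ind (e ∣? j)))) ⟩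
      ∑ (divisors m) (λ e → E (μ e) * ind (e ∣? j))        ∎

    sieve : ∀ m → 1 ≤ m → (xs : List ℕ) (F : ℕ → Carrier) →
            ∑ xs (λ j → ind (gcd j m ℕ.≟ 1) * F j) ≈ ∑ (divisors m) (λ e → E (μ e) * ∑ xs (λ j → ind (e ∣? j) * F j))
    sieve m 1≤m xs F = begin
      ∑ xs (λ j → ind (gcd j m ℕ.≟ 1) * F j)                            ≈⟨ ∑-cong xs (λ j → *-congʳ (ind-coprime m j 1≤m)) ⟩
      ∑ xs (λ j → ∑ (divisors m) (λ e → E (μ e) * ind (e ∣? j)) * F j)  ≈⟨ ∑-cong xs (λ j → sym (∑-*ʳ (divisors m) (F j) _)) ⟩
      ∑ xs (λ j → ∑ (divisors m) (λ e → E (μ e) * ind (e ∣? j) * F j))  ≈⟨ ∑-swap xs (divisors m) _ ⟩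
      ∑ (divisors m) (λ e → ∑ xs (λ j → E (μ e) * ind (e ∣? j) * F j))  ≈⟨ ∑-cong (divisors m) (λ e → ∑-cong xs (λ j → *-assoc _ _ _)) ⟩
      ∑ (divisors m) (λ e → ∑ xs (λ j → E (μ e) * (ind (e ∣? j) * F j))) ≈⟨ ∑-cong (divisors m) (λ e → ∑-*ˡ xs (E (μ e)) _) ⟩
      ∑ (divisors m) (λ e → E (μ e) * ∑ xs (λ j → ind (e ∣? j) * F j))  ∎

module RootsOfUnity {c ℓ : Level} (R : CommutativeRing c ℓ) where
  open CommutativeRing R
  open import Relation.Binary.Reasoning.Setoid setoid
  open import Tactic.RingSolver.NonReflective (fromCommutativeRing R (λ _ → nothing)) using (solve; _⊜_; _⊕_; _⊗_)
  import Algebra.Properties.Group +-group as +-Group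
  import Algebra.Properties.Ring ring as RingProperties
  open Sum R
  open Embedding R using (N)
  open Residues

  NoZeroDivisors : Set (c Level.⊔ ℓ)
  NoZeroDivisors = ∀ x y → x * y ≈ 0# → x ≈ 0# ⊎ y ≈ 0#

  IsPrimitiveRoot : Carrier → ℕ → Set ℓ
  IsPrimitiveRoot ω n = pow R ω n ≈ 1# × (∀ t → 1 ≤ t → t < n → ¬ pow R ω t ≈ 1#)

  pow-cong : ∀ {x y} k → x ≈ y → pow R x k ≈ pow R y k
  pow-cong zero e = refl
  pow-cong (suc k) e = *-cong e (pow-cong k e)

  pow-1 : ∀ k → pow R 1# k ≈ 1#
  pow-1 zero = refl
  pow-1 (suc k) = trans (*-identityˡ _) (pow-1 k)

  pow-+ : ∀ x a b → pow R x (a ℕ.+ b) ≈ pow R x a * pow R x b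
  pow-+ x zero b = sym (*-identityˡ _)
  pow-+ x (suc a) b = trans (*-congˡ (pow-+ x a b)) (sym (*-assoc _ _ _))

  pow-* : ∀ x a b → pow R x (a ℕ.* b) ≈ pow R (pow R x a) b
  pow-* x a zero = reflexive (P.cong (pow R x) (ℕₚ.*-zeroʳ a))
  pow-* x a (suc b) = begin
    pow R x (a ℕ.* suc b)               ≡⟨ P.cong (pow R x) (ℕₚ.*-suc a b) ⟩
    pow R x (a ℕ.+ a ℕ.* b)             ≈⟨ pow-+ x a (a ℕ.* b) ⟩
    pow R x a * pow R x (a ℕ.* b)       ≈⟨ *-congˡ (pow-* x a b) ⟩
    pow R x a * pow R (pow R x a) b     ∎

  power-primitive : ∀ ω n e q → 1 ≤ e → n ≡ e ℕ.* q → IsPrimitiveRoot ω n → IsPrimitiveRoot (pow R ω e) q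
  power-primitive ω n e q 1≤e n≡eq (ω^n≈1 , no-smaller-period) =
    trans (sym (pow-* ω e q)) (trans (reflexive (P.cong (pow R ω) (P.sym n≡eq))) ω^n≈1) ,
    λ t 1≤t t<q ω^et≈1 → no-smaller-period (e ℕ.* t) (ℕₚ.*-mono-≤ 1≤e 1≤t)
                           (P.subst (e ℕ.* t <_) (P.sym n≡eq) (ℕₚ.*-monoʳ-< e {{ℕ.>-nonZero 1≤e}} t<q))
                           (trans (pow-* ω e t) ω^et≈1)

  pow-% : ∀ ω d .{{_ : NonZero d}} → pow R ω d ≈ 1# → ∀ a → pow R ω a ≈ pow R ω (a % d)
  pow-% ω d ω^d≈1 a = begin
    pow R ω a                                        ≡⟨ P.cong (pow R ω) (DM.m≡m%n+[m/n]*n a d) ⟩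
    pow R ω (a % d ℕ.+ (a / d) ℕ.* d)                ≈⟨ pow-+ ω (a % d) _ ⟩
    pow R ω (a % d) * pow R ω ((a / d) ℕ.* d)        ≡⟨ P.cong (λ k → pow R ω (a % d) * pow R ω k) (ℕₚ.*-comm (a / d) d) ⟩
    pow R ω (a % d) * pow R ω (d ℕ.* (a / d))        ≈⟨ *-congˡ (trans (pow-* ω d (a / d)) (trans (pow-cong (a / d) ω^d≈1) (pow-1 (a / d)))) ⟩
    pow R ω (a % d) * 1#                             ≈⟨ *-identityʳ _ ⟩
    pow R ω (a % d)                                  ∎

  pow-≡-mod : ∀ ω d .{{_ : NonZero d}} → pow R ω d ≈ 1# → ∀ {a b} → + a ≡ + b [mod d ] → pow R ω a ≈ pow R ω b
  pow-≡-mod ω d ω^d≈1 {a} {b} a≡b =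
    trans (pow-% ω d ω^d≈1 a) (trans (reflexive (P.cong (pow R ω) (≡-mod⇒% a≡b))) (sym (pow-% ω d ω^d≈1 b)))

  -- (w - 1) Σ_{t<q} w^(t+1) = w^(q+1) - w, in additive form
  geometric-sum : ∀ w q → w * ∑ (upTo q) (λ t → pow R w (suc t)) + w ≈ ∑ (upTo q) (λ t → pow R w (suc t)) + pow R w (suc q)
  geometric-sum w zero = trans (+-congʳ (zeroʳ w)) (+-congˡ (sym (*-identityʳ w)))
  geometric-sum w (suc q) = begin
    w * ∑ (upTo (suc q)) g + w       ≈⟨ +-congʳ (*-congˡ (∑-upTo-suc q g)) ⟩
    w * (S + pow R w (suc q)) + w    ≈⟨ solve 3 (λ w S P → ((w ⊗ (S ⊕ P)) ⊕ w) ⊜ (((w ⊗ S) ⊕ w) ⊕ (w ⊗ P))) refl w S (pow R w (suc q)) ⟩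
    (w * S + w) + w * pow R w (suc q) ≈⟨ +-congʳ (geometric-sum w q) ⟩
    (S + pow R w (suc q)) + pow R w (suc (suc q)) ≈⟨ +-congʳ (sym (∑-upTo-suc q g)) ⟩
    ∑ (upTo (suc q)) g + pow R w (suc (suc q)) ∎
    where
    g : ℕ → Carrier
    g t = pow R w (suc t)
    S : Carrier
    S = ∑ (upTo q) g

  geometric-vanish : NoZeroDivisors → ∀ w q → pow R w q ≈ 1# → ¬ w ≈ 1# → ∑ (upTo q) (λ t → pow R w (suc t)) ≈ 0#
  geometric-vanish no-zero-divisors w q w^q≈1 w≉1 with no-zero-divisors (w - 1#) S product≈0
    where
    S : Carrier
    S = ∑ (upTo q) (λ t → pow R w (suc t))
    cancel : ∀ x y → (x + y) - y ≈ x
    cancel x y = trans (+-assoc _ _ _) (trans (+-congˡ (-‿inverseʳ y)) (+-identityʳ x))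
    fixed : w * S ≈ S
    fixed = begin
      w * S             ≈⟨ sym (cancel (w * S) w) ⟩
      (w * S + w) - w   ≈⟨ +-congʳ (trans (geometric-sum w q) (+-congˡ (trans (*-congˡ w^q≈1) (*-identityʳ w)))) ⟩
      (S + w) - w       ≈⟨ cancel S w ⟩
      S                 ∎
    product≈0 : (w - 1#) * S ≈ 0#
    product≈0 = begin
      (w - 1#) * S      ≈⟨ distribʳ S w (- 1#) ⟩
      w * S + - 1# * S  ≈⟨ +-congˡ (trans (sym (RingProperties.-‿distribˡ-* 1# S)) (-‿cong (*-identityˡ S))) ⟩
      w * S - S         ≈⟨ +-Group.x≈y⇒x∙y⁻¹≈ε fixed ⟩
      0#                ∎
  ... | inj₁ w-1≈0 = ⊥-elim (w≉1 (+-Group.x∙y⁻¹≈ε⇒x≈y w 1# w-1≈0))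
  ... | inj₂ S≈0 = S≈0

  roots-of-unity-sum : NoZeroDivisors → ∀ ν q → 1 ≤ q → IsPrimitiveRoot ν q → ∀ (x : ℤ) →
                       ∑ (upTo q) (λ t → pow R ν (suc t ℕ.* modN x q)) ≈ N q * ind (q ∣? ∣ x ∣)
  roots-of-unity-sum no-zero-divisors ν q 1≤q (ν^q≈1 , no-smaller-period) x with modN x q in eq
  ... | zero = begin
    ∑ (upTo q) (λ t → pow R ν (suc t ℕ.* 0)) ≈⟨ ∑-cong (upTo q) (λ t → reflexive (P.cong (pow R ν) (ℕₚ.*-zeroʳ (suc t)))) ⟩
    ∑ (upTo q) (λ _ → 1#)                    ≈⟨ ∑-1 (upTo q) ⟩
    N (length (upTo q))                      ≡⟨ P.cong N (Listₚ.length-upTo q) ⟩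
    N q                                      ≈⟨ sym (*-identityʳ _) ⟩
    N q * 1#                                 ≈⟨ *-congˡ (sym (ind-yes (q ∣? ∣ x ∣) (modN≡0⇒∣ x q {{ℕ.>-nonZero 1≤q}} eq))) ⟩
    N q * ind (q ∣? ∣ x ∣)                   ∎
  ... | suc a = begin
    ∑ (upTo q) (λ t → pow R ν (suc t ℕ.* suc a)) ≈⟨ ∑-cong (upTo q) (λ t → trans (reflexive (P.cong (pow R ν) (ℕₚ.*-comm (suc t) (suc a))))
                                                                             (pow-* ν (suc a) (suc t))) ⟩
    ∑ (upTo q) (λ t → pow R w (suc t))           ≈⟨ geometric-vanish no-zero-divisors w q w^q≈1 w≉1 ⟩
    0#                                           ≈⟨ sym (trans (*-congˡ (ind-no (q ∣? ∣ x ∣) q∤x)) (zeroʳ _)) ⟩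
    N q * ind (q ∣? ∣ x ∣)                       ∎
    where
    instance _ = ℕ.>-nonZero 1≤q
    w : Carrier
    w = pow R ν (suc a)
    w^q≈1 : pow R w q ≈ 1#
    w^q≈1 = begin
      pow R w q                ≈⟨ sym (pow-* ν (suc a) q) ⟩
      pow R ν (suc a ℕ.* q)    ≡⟨ P.cong (pow R ν) (ℕₚ.*-comm (suc a) q) ⟩
      pow R ν (q ℕ.* suc a)    ≈⟨ pow-* ν q (suc a) ⟩
      pow R (pow R ν q) (suc a) ≈⟨ trans (pow-cong (suc a) ν^q≈1) (pow-1 (suc a)) ⟩
      1#                       ∎
    w≉1 : ¬ w ≈ 1#
    w≉1 = no-smaller-period (suc a) (s≤s z≤n) (P.subst (_< q) eq (modN< x q))
    q∤x : ¬ q ∣ ∣ x ∣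
    q∤x q∣x = ℕₚ.0≢1+n (P.trans (P.sym (∣⇒modN≡0 x q q∣x)) eq)

vonSterneck : ℕ → ℤ → ℤ
vonSterneck n y = Z.∑ (divisors n) (λ d → (+ d *ℤ μ (divN n d)) *ℤ Z.ind (d ∣? ∣ y ∣))

module Ramanujan {c ℓ : Level} (R : CommutativeRing c ℓ) where
  open CommutativeRing R
  open import Relation.Binary.Reasoning.Setoid setoid
  open Sum R
  open Embedding R
  open RootsOfUnity R
  open Residues

  -- Σ_{1 ≤ j ≤ n, e ∣ j} ω^(j x) = (n/e) [n/e ∣ x]: with n = e q the terms run
  -- over the powers ν^(t x), 1 ≤ t ≤ q, of the primitive q-th root ν = ω^e
  ∑-over-multiples : NoZeroDivisors → ∀ n ω → 1 ≤ n → IsPrimitiveRoot ω n → ∀ (x : ℤ) e → e ∣ n →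
                     ∑ (range1 n) (λ j → ind (e ∣? j) * pow R ω (modN (+ j *ℤ x) n)) ≈ N (divN n e) * ind (divN n e ∣? ∣ x ∣)
  ∑-over-multiples no-zero-divisors n ω 1≤n ω-primitive x e (divides q n≡qe) = begin
    ∑ (range1 n) (λ j → ind (e ∣? j) * G j)                  ≡⟨ ∑-range1 n _ ⟩
    ∑ (upTo n) (λ i → ind (e ∣? suc i) * G (suc i))          ≡⟨ P.cong (λ k → ∑ (upTo k) (λ i → ind (e ∣? suc i) * G (suc i))) n≡qe ⟩
    ∑ (upTo (q ℕ.* e)) (λ i → ind (e ∣? suc i) * G (suc i))  ≈⟨ ∑-multiples e q 1≤e G ⟩
    ∑ (upTo q) (λ t → G (e ℕ.* suc t))                       ≈⟨ ∑-upTo-cong q (λ t _ → term t) ⟩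
    ∑ (upTo q) (λ t → pow R ν (suc t ℕ.* modN x q))          ≈⟨ roots-of-unity-sum no-zero-divisors ν q 1≤q ν-primitive x ⟩
    N q * ind (q ∣? ∣ x ∣)                                   ≡⟨ P.cong (λ k → N k * ind (k ∣? ∣ x ∣)) (P.sym (divN-exact q e 1≤e n≡qe)) ⟩
    N (divN n e) * ind (divN n e ∣? ∣ x ∣)                   ∎
    where
    G : ℕ → Carrier
    G j = pow R ω (modN (+ j *ℤ x) n)
    1≤q : 1 ≤ q
    1≤q = proj₁ (factors-pos q e 1≤n n≡qe)
    1≤e : 1 ≤ e
    1≤e = proj₂ (factors-pos q e 1≤n n≡qe)
    instance _ = ℕ.>-nonZero 1≤n
    instance _ = ℕ.>-nonZero 1≤q
    n≡eq : n ≡ e ℕ.* q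
    n≡eq = P.trans n≡qe (ℕₚ.*-comm q e)
    ν : Carrier
    ν = pow R ω e
    ν-primitive : IsPrimitiveRoot ν q
    ν-primitive = power-primitive ω n e q 1≤e n≡eq ω-primitive
    congruent : ∀ t → + (e ℕ.* suc t) *ℤ x ≡ + (e ℕ.* (suc t ℕ.* modN x q)) [mod n ]
    congruent t = P.subst (+ (e ℕ.* suc t) *ℤ x ≡ + (e ℕ.* (suc t ℕ.* modN x q)) [mod_]) (P.sym n≡eq) (≡-mod-scaled-residue e (suc t) x q)
    -- ω^(j x mod n) only depends on j x modulo n
    term : ∀ t → G (e ℕ.* suc t) ≈ pow R ν (suc t ℕ.* modN x q)
    term t = trans (pow-≡-mod ω n (proj₁ ω-primitive) (≡-mod-trans (≡-mod-sym (modN-≡ (+ (e ℕ.* suc t) *ℤ x) n)) (congruent t)))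
                   (pow-* ω e (suc t ℕ.* modN x q))

  -- von Sterneck's formula: sieve the condition gcd(j, n) = 1, evaluate the
  -- sums over multiples of e ∣ n, and re-index by d = n/e
  ramanujan-vonSterneck : NoZeroDivisors → ∀ n ω → 1 ≤ n → IsPrimitiveRoot ω n → ∀ x → ramanujan R ω n x ≈ E (vonSterneck n x)
  ramanujan-vonSterneck no-zero-divisors n ω 1≤n ω-primitive x = begin
    ramanujan R ω n x                                  ≡⟨ sumR-map (coprimeList n) G ⟩
    ∑ (coprimeList n) G                                ≈⟨ ∑-filter (λ j → gcd j n ℕ.≟ 1) (range1 n) G ⟩
    ∑ (range1 n) (λ j → ind (gcd j n ℕ.≟ 1) * G j)     ≈⟨ Sieve.sieve R n 1≤n (range1 n) G ⟩
    ∑ (divisors n) (λ e → E (μ e) * ∑ (range1 n) (λ j → ind (e ∣? j) * G j))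
      ≈⟨ ∑-divisors-cong n (λ e e∣n → *-congˡ (∑-over-multiples no-zero-divisors n ω 1≤n ω-primitive x e e∣n)) ⟩
    ∑ (divisors n) (λ e → F e (divN n e))              ≈⟨ ∑-divisors-flip n F ⟩
    ∑ (divisors n) (λ d → F (divN n d) d)              ≈⟨ ∑-cong (divisors n) term ⟩
    ∑ (divisors n) (λ d → E ((+ d *ℤ μ (divN n d)) *ℤ Z.ind (d ∣? ∣ x ∣))) ≈⟨ sym (E-∑ (divisors n) _) ⟩
    E (vonSterneck n x)                                ∎
    where
    G : ℕ → Carrier
    G j = pow R ω (modN (+ j *ℤ x) n)
    F : ℕ → ℕ → Carrier
    F e d = E (μ e) * (N d * ind (d ∣? ∣ x ∣))
    term : ∀ d → F (divN n d) d ≈ E ((+ d *ℤ μ (divN n d)) *ℤ Z.ind (d ∣? ∣ x ∣))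
    term d = begin
      E (μ (divN n d)) * (N d * ind (d ∣? ∣ x ∣))              ≈⟨ trans (sym (*-assoc _ _ _)) (*-congʳ (*-comm _ _)) ⟩
      (N d * E (μ (divN n d))) * ind (d ∣? ∣ x ∣)              ≈⟨ sym (*-cong (E-* (+ d) (μ (divN n d))) (E-ind (d ∣? ∣ x ∣))) ⟩
      E (+ d *ℤ μ (divN n d)) * E (Z.ind (d ∣? ∣ x ∣))         ≈⟨ sym (E-* (+ d *ℤ μ (divN n d)) (Z.ind (d ∣? ∣ x ∣))) ⟩
      E ((+ d *ℤ μ (divN n d)) *ℤ Z.ind (d ∣? ∣ x ∣))          ∎

-- Equidistribution: for L ∣ m the reduced residues modulo m are spread evenly
-- over the reduced residues modulo L; each class x (gcd(x, L) = 1) contains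
-- φ(m)/φ(L) of them.  Proved by sieving the condition gcd(k, m) = 1 and
-- counting the multiples of each e ∣ m in a residue class modulo L.
module Equidistribution where
  open P using (cong; sym; trans; subst)
  open Residues

  unique-solution : ∀ e L x .{{_ : NonZero L}} → Coprime e L → x < L → Z.∑ (upTo L) (λ u → Z.ind ((e ℕ.* u) % L ℕ.≟ x)) ≡ 1ℤ
  unique-solution e L x e⊥L x<L = trans (Z.∑-upTo-single L u₀ _ (modN< (+ x *ℤ e⁻¹) L) others) (Z.ind-yes ((e ℕ.* u₀) % L ℕ.≟ x) solves)
    where
    e⁻¹ : ℤ
    e⁻¹ = proj₁ (coprime⇒inverse e⊥L)
    e⁻¹-inverse : e⁻¹ *ℤ + e ≡ 1ℤ [mod L ]
    e⁻¹-inverse = proj₂ (coprime⇒inverse e⊥L)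
    u₀ : ℕ
    u₀ = modN (+ x *ℤ e⁻¹) L
    commute : ∀ (a b c : ℤ) → a *ℤ (b *ℤ c) ≡ b *ℤ (c *ℤ a)
    commute = solve-∀
    solves : (e ℕ.* u₀) % L ≡ x
    solves = trans (≡-mod⇒% e-u₀≡x) (DM.m<n⇒m%n≡m x<L)
      where
      open ≡-mod-Reasoning L
      e-u₀≡x : + (e ℕ.* u₀) ≡ + x [mod L ]
      e-u₀≡x = begin
        + (e ℕ.* u₀)            ≡⟨ ℤₚ.pos-* e u₀ ⟩
        + e *ℤ + u₀             ≈⟨ ≡-mod-* (≡-mod-refl {+ e}) (≡-mod-sym (modN-≡ (+ x *ℤ e⁻¹) L)) ⟩
        + e *ℤ (+ x *ℤ e⁻¹)       ≡⟨ commute (+ e) (+ x) e⁻¹ ⟩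
        + x *ℤ (e⁻¹ *ℤ + e)       ≈⟨ ≡-mod-* (≡-mod-refl {+ x}) e⁻¹-inverse ⟩
        + x *ℤ 1ℤ               ≡⟨ ℤₚ.*-identityʳ (+ x) ⟩
        + x                     ∎
    only : ∀ u → u < L → (e ℕ.* u) % L ≡ x → u ≡ u₀
    only u u<L eu≡x = ≡-mod-unique u≡u₀ u<L (modN< (+ x *ℤ e⁻¹) L)
      where
      open ≡-mod-Reasoning L
      u≡u₀ : + u ≡ + u₀ [mod L ]
      u≡u₀ = begin
        + u                     ≡⟨ sym (ℤₚ.*-identityˡ (+ u)) ⟩
        1ℤ *ℤ + u               ≈⟨ ≡-mod-* (≡-mod-sym e⁻¹-inverse) (≡-mod-refl {+ u}) ⟩
        (e⁻¹ *ℤ + e) *ℤ + u       ≡⟨ trans (ℤₚ.*-assoc e⁻¹ (+ e) (+ u)) (cong (e⁻¹ *ℤ_) (sym (ℤₚ.pos-* e u))) ⟩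
        e⁻¹ *ℤ + (e ℕ.* u)        ≈⟨ ≡-mod-* (≡-mod-refl {e⁻¹}) (subst (λ r → + (e ℕ.* u) ≡ + r [mod L ]) eu≡x (%-≡-mod (e ℕ.* u) L)) ⟩
        e⁻¹ *ℤ + x                ≡⟨ ℤₚ.*-comm e⁻¹ (+ x) ⟩
        + x *ℤ e⁻¹                ≈⟨ modN-≡ (+ x *ℤ e⁻¹) L ⟩
        + u₀                    ∎
    others : ∀ u → u < L → ¬ u ≡ u₀ → Z.ind ((e ℕ.* u) % L ℕ.≟ x) ≡ 0ℤ
    others u u<L u≢u₀ = Z.ind-no ((e ℕ.* u) % L ℕ.≟ x) (λ eu≡x → u≢u₀ (only u u<L eu≡x))

  ∑-class-of-multiples : ∀ e L x M .{{_ : NonZero L}} → Coprime e L → x < L → L ∣ M →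
                         Z.∑ (upTo M) (λ t → Z.ind ((e ℕ.* suc t) % L ℕ.≟ x)) ≡ + (M / L)
  ∑-class-of-multiples e L x M e⊥L x<L (divides B M≡BL) = begin
    Z.∑ (upTo M) (λ t → h (suc t))                                  ≡⟨ Z.∑-upTo-shift M h h-period ⟩
    Z.∑ (upTo M) h                                                  ≡⟨ cong (λ k → Z.∑ (upTo k) h) M≡BL ⟩
    Z.∑ (upTo (B ℕ.* L)) h                                          ≡⟨ Z.∑-upTo-blocks B L h ⟩
    Z.∑ (upTo B) (λ b → Z.∑ (upTo L) (λ u → h (b ℕ.* L ℕ.+ u)))     ≡⟨ Z.∑-upTo-cong B (λ b _ → Z.∑-upTo-cong L (λ u _ → h-shift b u)) ⟩
    Z.∑ (upTo B) (λ b → Z.∑ (upTo L) h)                             ≡⟨ Z.∑-upTo-cong B (λ b _ → unique-solution e L x e⊥L x<L) ⟩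
    Z.∑ (upTo B) (λ _ → 1ℤ)                                         ≡⟨ trans (Z.∑-1 (upTo B)) (trans (natR-ℤ _) (cong +_ (Listₚ.length-upTo B))) ⟩
    + B                                                             ≡⟨ cong +_ (sym (trans (cong (_/ L) M≡BL) (DM.m*n/n≡m B L))) ⟩
    + (M / L)                                                       ∎
    where
    open P.≡-Reasoning
    h : ℕ → ℤ
    h v = Z.ind ((e ℕ.* v) % L ℕ.≟ x)
    h-cong : ∀ {v w} → (e ℕ.* v) % L ≡ (e ℕ.* w) % L → h v ≡ h w
    h-cong {v} {w} eq = Z.ind-cong ((e ℕ.* v) % L ℕ.≟ x) ((e ℕ.* w) % L ℕ.≟ x) (trans (sym eq)) (trans eq)
    h-period : h M ≡ h 0
    h-period = h-cong (trans (n∣m⇒m%n≡0 (e ℕ.* M) L (∣n⇒∣m*n e (divides B M≡BL)))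
                             (sym (trans (cong (_% L) (ℕₚ.*-zeroʳ e)) (n∣m⇒m%n≡0 0 L (L ∣0)))))
    h-shift : ∀ b u → h (b ℕ.* L ℕ.+ u) ≡ h u
    h-shift b u = h-cong (trans (cong (_% L) expand) (DM.%-remove-+ʳ (e ℕ.* u) (n∣m*n (e ℕ.* b))))
      where
      expand : e ℕ.* (b ℕ.* L ℕ.+ u) ≡ e ℕ.* u ℕ.+ e ℕ.* b ℕ.* L
      expand = trans (ℕₚ.*-distribˡ-+ e (b ℕ.* L) u) (trans (ℕₚ.+-comm (e ℕ.* (b ℕ.* L)) (e ℕ.* u)) (cong (e ℕ.* u ℕ.+_) (sym (ℕₚ.*-assoc e b L))))

  multiplesInClass : ℕ → (L : ℕ) → .{{_ : NonZero L}} → ℕ → ℕ → ℤ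
  multiplesInClass m L x e = Z.∑ (range1 m) (λ k → Z.ind (e ∣? k) *ℤ Z.ind (k % L ℕ.≟ x))

  multiplesInClass-nonunit : ∀ m L x e .{{_ : NonZero L}} → Coprime x L → ¬ gcd e L ≡ 1 → multiplesInClass m L x e ≡ 0ℤ
  multiplesInClass-nonunit m L x e x⊥L gcd≢1 = trans (Z.∑-cong (range1 m) term) (Z.∑-0 (range1 m))
    where
    term : ∀ k → Z.ind (e ∣? k) *ℤ Z.ind (k % L ℕ.≟ x) ≡ 0ℤ
    term k with e ∣? k | k % L ℕ.≟ x
    ... | no _ | _ = P.refl
    ... | yes _ | no _ = P.refl
    ... | yes e∣k | yes k%L≡x = ⊥-elim (gcd≢1 (x⊥L (g∣x , gcd[m,n]∣n e L)))
      where
      g∣x : gcd e L ∣ x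
      g∣x = subst (gcd e L ∣_) k%L≡x (%-presˡ-∣ (∣-trans (gcd[m,n]∣m e L) e∣k) (gcd[m,n]∣n e L))

  multiplesInClass-unit : ∀ m L x e .{{_ : NonZero L}} → 1 ≤ m → L ∣ m → e ∣ m → Coprime e L → x < L →
                          multiplesInClass m L x e ≡ + divN (divN m e) L
  multiplesInClass-unit m L x e 1≤m L∣m (divides M m≡Me) e⊥L x<L = begin
    multiplesInClass m L x e                                                  ≡⟨ Z.∑-range1 m _ ⟩
    Z.∑ (upTo m) (λ i → Z.ind (e ∣? suc i) *ℤ Z.ind (suc i % L ℕ.≟ x))        ≡⟨ cong (λ k → Z.∑ (upTo k) (λ i → Z.ind (e ∣? suc i) *ℤ Z.ind (suc i % L ℕ.≟ x))) m≡Me ⟩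
    Z.∑ (upTo (M ℕ.* e)) (λ i → Z.ind (e ∣? suc i) *ℤ Z.ind (suc i % L ℕ.≟ x)) ≡⟨ Z.∑-multiples e M 1≤e (λ k → Z.ind (k % L ℕ.≟ x)) ⟩
    Z.∑ (upTo M) (λ t → Z.ind ((e ℕ.* suc t) % L ℕ.≟ x))                      ≡⟨ ∑-class-of-multiples e L x M e⊥L x<L L∣M ⟩
    + (M / L)                                                                 ≡⟨ cong +_ (trans (sym (divN≡/ M L)) (cong (λ k → divN k L) (sym (divN-exact M e 1≤e m≡Me)))) ⟩
    + divN (divN m e) L                                                       ∎
    where
    open P.≡-Reasoning
    1≤e : 1 ≤ e
    1≤e = proj₂ (factors-pos M e 1≤m m≡Me)
    L∣M : L ∣ M
    L∣M = coprime-divisor (Coprime.sym e⊥L) (subst (L ∣_) (trans m≡Me (ℕₚ.*-comm M e)) L∣m)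

  classSize : ℕ → (L : ℕ) → .{{_ : NonZero L}} → ℕ → ℤ
  classSize m L x = Z.∑ (coprimeList m) (λ k → Z.ind (k % L ℕ.≟ x))

  classSize-sieve : ∀ m L x .{{_ : NonZero L}} → 1 ≤ m → classSize m L x ≡ Z.∑ (divisors m) (λ e → μ e *ℤ multiplesInClass m L x e)
  classSize-sieve m L x 1≤m = begin
    classSize m L x                                                            ≡⟨ Z.∑-filter (λ j → gcd j m ℕ.≟ 1) (range1 m) _ ⟩
    Z.∑ (range1 m) (λ k → Z.ind (gcd k m ℕ.≟ 1) *ℤ Z.ind (k % L ℕ.≟ x))        ≡⟨ Sieve.sieve ℤₚ.+-*-commutativeRing m 1≤m (range1 m) _ ⟩
    Z.∑ (divisors m) (λ e → embedℤ ℤₚ.+-*-commutativeRing (μ e) *ℤ multiplesInClass m L x e)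
      ≡⟨ Z.∑-cong (divisors m) (λ e → cong (_*ℤ multiplesInClass m L x e) (embedℤ-ℤ (μ e))) ⟩
    Z.∑ (divisors m) (λ e → μ e *ℤ multiplesInClass m L x e)                   ∎
    where open P.≡-Reasoning

  -- the sieve formula for a class prime to L does not depend on the class
  classSize-unit : ∀ m L x .{{_ : NonZero L}} → 1 ≤ m → L ∣ m → Coprime x L → x < L →
                   classSize m L x ≡ Z.∑ (divisors m) (λ e → μ e *ℤ (Z.ind (gcd e L ℕ.≟ 1) *ℤ + divN (divN m e) L))
  classSize-unit m L x 1≤m L∣m x⊥L x<L = trans (classSize-sieve m L x 1≤m) (Z.∑-divisors-cong m term)
    where
    term : ∀ e → e ∣ m → μ e *ℤ multiplesInClass m L x e ≡ μ e *ℤ (Z.ind (gcd e L ℕ.≟ 1) *ℤ + divN (divN m e) L)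
    term e e∣m with gcd e L ℕ.≟ 1
    ... | yes gcd≡1 = cong (μ e *ℤ_) (trans (multiplesInClass-unit m L x e 1≤m L∣m e∣m (gcd≡1⇒coprime gcd≡1) x<L) (sym (ℤₚ.*-identityˡ _)))
    ... | no gcd≢1 = cong (μ e *ℤ_) (multiplesInClass-nonunit m L x e x⊥L gcd≢1)

  classSize-nonunit : ∀ m L x .{{_ : NonZero L}} → L ∣ m → ¬ Coprime x L → classSize m L x ≡ 0ℤ
  classSize-nonunit m L x L∣m x⊥̸L = trans (Z.∑-filter (λ j → gcd j m ℕ.≟ 1) (range1 m) _) (trans (Z.∑-cong (range1 m) term) (Z.∑-0 (range1 m)))
    where
    term : ∀ k → Z.ind (gcd k m ℕ.≟ 1) *ℤ Z.ind (k % L ℕ.≟ x) ≡ 0ℤ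
    term k with gcd k m ℕ.≟ 1 | k % L ℕ.≟ x
    ... | no _ | _ = P.refl
    ... | yes _ | no _ = P.refl
    ... | yes gcd≡1 | yes k%L≡x = ⊥-elim (x⊥̸L λ (c∣x , c∣L) →
            gcd≡1⇒coprime gcd≡1 (∣n∣m%n⇒∣m c∣L (subst (_ ∣_) (sym k%L≡x) c∣x) , ∣-trans c∣L L∣m))

  unitClassCount : ℕ → (L : ℕ) → .{{_ : NonZero L}} → ℕ
  unitClassCount m L = length (filter (λ k → k % L ℕ.≟ 1 % L) (coprimeList m))

  classSize-value : ∀ m L x .{{_ : NonZero L}} → 1 ≤ m → L ∣ m → x < L → classSize m L x ≡ Z.ind (gcd x L ℕ.≟ 1) *ℤ + unitClassCount m L
  classSize-value m L x 1≤m L∣m x<L with gcd x L ℕ.≟ 1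
  ... | no gcd≢1 = classSize-nonunit m L x L∣m (gcd≢1 ∘ coprime⇒gcd≡1)
  ... | yes gcd≡1 = begin
    classSize m L x              ≡⟨ classSize-unit m L x 1≤m L∣m (gcd≡1⇒coprime gcd≡1) x<L ⟩
    _                            ≡⟨ sym (classSize-unit m L (1 % L) 1≤m L∣m 1%L⊥L (DM.m%n<n 1 L)) ⟩
    classSize m L (1 % L)        ≡⟨ sym (length-filter-ℤ (λ k → k % L ℕ.≟ 1 % L) (coprimeList m)) ⟩
    + unitClassCount m L         ≡⟨ sym (ℤₚ.*-identityˡ _) ⟩
    1ℤ *ℤ + unitClassCount m L   ∎
    where
    open P.≡-Reasoning
    1%L⊥L : Coprime (1 % L) L
    1%L⊥L (c∣1%L , c∣L) = ∣1⇒≡1 (∣n∣m%n⇒∣m c∣L c∣1%L)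

  equidistribution : ∀ m L .{{_ : NonZero L}} → 1 ≤ m → L ∣ m → (Q : ℕ → ℤ) →
                     Z.∑ (coprimeList m) (λ k → Q (k % L)) ≡ + unitClassCount m L *ℤ Z.∑ (upTo L) (λ x → Z.ind (gcd x L ℕ.≟ 1) *ℤ Q x)
  equidistribution m L 1≤m L∣m Q = begin
    Z.∑ (coprimeList m) (λ k → Q (k % L))                                      ≡⟨ Z.∑-cong (coprimeList m) (λ k → sym (pick k)) ⟩
    Z.∑ (coprimeList m) (λ k → Z.∑ (upTo L) (λ x → Z.ind (k % L ℕ.≟ x) *ℤ Q x)) ≡⟨ Z.∑-swap (coprimeList m) (upTo L) _ ⟩
    Z.∑ (upTo L) (λ x → Z.∑ (coprimeList m) (λ k → Z.ind (k % L ℕ.≟ x) *ℤ Q x)) ≡⟨ Z.∑-cong (upTo L) (λ x → Z.∑-*ʳ (coprimeList m) (Q x) _) ⟩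
    Z.∑ (upTo L) (λ x → classSize m L x *ℤ Q x)
      ≡⟨ Z.∑-upTo-cong L (λ x x<L → trans (cong (_*ℤ Q x) (classSize-value m L x 1≤m L∣m x<L)) (rearrange (Z.ind (gcd x L ℕ.≟ 1)) (+ f) (Q x))) ⟩
    Z.∑ (upTo L) (λ x → + f *ℤ (Z.ind (gcd x L ℕ.≟ 1) *ℤ Q x))                ≡⟨ Z.∑-*ˡ (upTo L) (+ f) _ ⟩
    + f *ℤ Z.∑ (upTo L) (λ x → Z.ind (gcd x L ℕ.≟ 1) *ℤ Q x)                  ∎
    where
    open P.≡-Reasoning
    f : ℕ
    f = unitClassCount m L
    rearrange : ∀ (a b c : ℤ) → (a *ℤ b) *ℤ c ≡ b *ℤ (a *ℤ c)
    rearrange = solve-∀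
    pick : ∀ k → Z.∑ (upTo L) (λ x → Z.ind (k % L ℕ.≟ x) *ℤ Q x) ≡ Q (k % L)
    pick k = trans (Z.∑-upTo-single L (k % L) _ (DM.m%n<n k L) (λ x _ x≢ → cong (_*ℤ Q x) (Z.ind-no (k % L ℕ.≟ x) (x≢ ∘ sym))))
                   (trans (cong (_*ℤ Q (k % L)) (Z.ind-yes (k % L ℕ.≟ k % L) P.refl)) (ℤₚ.*-identityˡ _))

  φ≥1 : ∀ L → 1 ≤ L → 1 ≤ φ L
  φ≥1 L 1≤L = nonempty (∈-filter⁺ (λ j → gcd j L ℕ.≟ 1) (∈-map⁺ suc (∈-upTo⁺ 1≤L)) (gcd-zeroˡ L))
    where
    nonempty : ∀ {xs : List ℕ} → 1 ∈ xs → 1 ≤ length xs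
    nonempty {_ ∷ _} _ = s≤s z≤n

  φ-∑ : ∀ L → + φ L ≡ Z.∑ (upTo L) (λ x → Z.ind (gcd x L ℕ.≟ 1))
  φ-∑ L = trans (length-filter-ℤ (λ j → gcd j L ℕ.≟ 1) (range1 L))
                (trans (Z.∑-range1 L _) (Z.∑-upTo-shift L (λ x → Z.ind (gcd x L ℕ.≟ 1)) (Z.ind-cong (gcd L L ℕ.≟ 1) (gcd 0 L ℕ.≟ 1) (trans gcd≡) (trans (sym gcd≡)))))
    where
    gcd≡ : gcd 0 L ≡ gcd L L
    gcd≡ = trans (gcd-identityˡ L) (sym (∣-antisym (gcd[m,n]∣m L L) (gcd-greatest ∣-refl ∣-refl)))

  φ-multiple : ∀ m L .{{_ : NonZero L}} → 1 ≤ m → L ∣ m → φ m ≡ unitClassCount m L ℕ.* φ L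
  φ-multiple m L 1≤m L∣m = ℤₚ.+-injective (begin
    + φ m                                                                 ≡⟨ sym (trans (Z.∑-1 (coprimeList m)) (natR-ℤ (φ m))) ⟩
    Z.∑ (coprimeList m) (λ _ → 1ℤ)                                        ≡⟨ equidistribution m L 1≤m L∣m (λ _ → 1ℤ) ⟩
    + f *ℤ Z.∑ (upTo L) (λ x → Z.ind (gcd x L ℕ.≟ 1) *ℤ 1ℤ)              ≡⟨ cong (+ f *ℤ_) (Z.∑-cong (upTo L) (λ x → ℤₚ.*-identityʳ _)) ⟩
    + f *ℤ Z.∑ (upTo L) (λ x → Z.ind (gcd x L ℕ.≟ 1))                     ≡⟨ cong (+ f *ℤ_) (sym (φ-∑ L)) ⟩
    + f *ℤ + φ L                                                          ≡⟨ sym (ℤₚ.pos-* f (φ L)) ⟩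
    + (f ℕ.* φ L)                                                         ∎)
    where
    open P.≡-Reasoning
    f : ℕ
    f = unitClassCount m L

module Families where
  open P using (cong; cong₂; sym; trans; subst)

  ∣lcmF : ∀ {r} (t : Fin r → ℕ) i → t i ∣ lcmF t
  ∣lcmF t fzero = m∣lcm[m,n] (t fzero) _
  ∣lcmF t (fsuc i) = ∣-trans (∣lcmF (t ∘ fsuc) i) (n∣lcm[m,n] (t fzero) _)

  lcmF-least : ∀ {r} (t : Fin r → ℕ) {c} → (∀ i → t i ∣ c) → lcmF t ∣ c
  lcmF-least {zero} t h = 1∣ _
  lcmF-least {suc r} t h = lcm-least (h fzero) (lcmF-least (t ∘ fsuc) (h ∘ fsuc))

  lcmF-mono : ∀ {r} (t ms : Fin r → ℕ) → (∀ i → t i ∣ ms i) → lcmF t ∣ lcmF ms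
  lcmF-mono t ms h = lcmF-least t (λ i → ∣-trans (h i) (∣lcmF ms i))

  lcm∣* : ∀ a b → lcm a b ∣ a ℕ.* b
  lcm∣* a b = lcm-least (∣m⇒∣m*n b (∣-refl {a})) (∣n⇒∣m*n a (∣-refl {b}))

  lcmF≥1 : ∀ {r} (t : Fin r → ℕ) → (∀ i → 1 ≤ t i) → 1 ≤ lcmF t
  lcmF≥1 {zero} t h = s≤s z≤n
  lcmF≥1 {suc r} t h = ℕ.>-nonZero⁻¹ _ {{ℕ.≢-nonZero λ lcm≡0 → ℕₚ.<⇒≢ (ℕₚ.*-mono-≤ (h fzero) rest≥1)
                          (sym (0∣⇒≡0 (subst (_∣ t fzero ℕ.* lcmF (t ∘ fsuc)) lcm≡0 (lcm∣* (t fzero) (lcmF (t ∘ fsuc))))))}}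
    where
    rest≥1 : 1 ≤ lcmF (t ∘ fsuc)
    rest≥1 = lcmF≥1 (t ∘ fsuc) (h ∘ fsuc)

  coprime-* : ∀ {x a b} → Coprime x a → Coprime x b → Coprime x (a ℕ.* b)
  coprime-* x⊥a x⊥b (c∣x , c∣ab) = x⊥b (c∣x , coprime-divisor (λ (d∣c , d∣a) → x⊥a (∣-trans d∣c c∣x , d∣a)) c∣ab)

  coprime-lcmF : ∀ {r} (t : Fin r → ℕ) x → (∀ i → Coprime x (t i)) → Coprime x (lcmF t)
  coprime-lcmF {zero} t x h (_ , c∣1) = ∣1⇒≡1 c∣1
  coprime-lcmF {suc r} t x h (c∣x , c∣lcm) =
    coprime-* (h fzero) (coprime-lcmF (t ∘ fsuc) x (h ∘ fsuc)) (c∣x , ∣-trans c∣lcm (lcm∣* (t fzero) (lcmF (t ∘ fsuc))))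

  lcmF-coprime : ∀ {r} (t : Fin r → ℕ) x → Coprime x (lcmF t) → ∀ i → Coprime x (t i)
  lcmF-coprime t x h i (c∣x , c∣ti) = h (c∣x , ∣-trans c∣ti (∣lcmF t i))

  divisorTuples-∣ : ∀ {r} (ms : Fin r → ℕ) t → t ∈ divisorTuples ms → ∀ i → t i ∣ ms i
  divisorTuples-∣ {suc r} ms t t∈ i with find (∈-concatMap⁻ (λ d → map (consF d) (divisorTuples (ms ∘ fsuc))) {xs = divisors (ms fzero)} t∈)
  ... | d , d∈ , t∈tail with ∈-map⁻ (consF d) t∈tail
  ...   | t′ , t′∈ , P.refl with i
  ...     | fzero = proj₂ (∈-filter⁻ (_∣? ms fzero) {xs = range1 (ms fzero)} d∈)
  ...     | fsuc j = divisorTuples-∣ (ms ∘ fsuc) t′ t′∈ j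

  prodFinℤ-cong : ∀ {r} {f g : Fin r → ℤ} → (∀ i → f i ≡ g i) → prodFinℤ f ≡ prodFinℤ g
  prodFinℤ-cong {zero} e = P.refl
  prodFinℤ-cong {suc r} e = cong₂ _*ℤ_ (e fzero) (prodFinℤ-cong (e ∘ fsuc))

  prodFinℤ-* : ∀ {r} (f g : Fin r → ℤ) → prodFinℤ (λ i → f i *ℤ g i) ≡ prodFinℤ f *ℤ prodFinℤ g
  prodFinℤ-* {zero} f g = P.refl
  prodFinℤ-* {suc r} f g = trans (cong (f fzero *ℤ g fzero *ℤ_) (prodFinℤ-* (f ∘ fsuc) (g ∘ fsuc))) (interchange (f fzero) (g fzero) _ _)
    where
    interchange : ∀ (a b c d : ℤ) → (a *ℤ b) *ℤ (c *ℤ d) ≡ (a *ℤ c) *ℤ (b *ℤ d)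
    interchange = solve-∀

  ind-all : ∀ {r} {P : Fin r → Set ℓ₁} (D : ∀ i → Dec (P i)) → Z.ind (all? D) ≡ prodFinℤ (λ i → Z.ind (D i))
  ind-all {r = zero} D = Z.ind-yes (all? D) (λ ())
  ind-all {r = suc r} D = trans (Z.ind-cong (all? D) (D fzero ×-dec all? (D ∘ fsuc)) (λ h → h fzero , h ∘ fsuc) (λ { (a , b) fzero → a ; (a , b) (fsuc i) → b i }))
                     (trans (Z.ind-× (D fzero) (all? (D ∘ fsuc))) (cong (Z.ind (D fzero) *ℤ_) (ind-all (D ∘ fsuc))))

  prod-∑-divisors : ∀ {r} (ms : Fin r → ℕ) (h : Fin r → ℕ → ℤ) →
                    prodFinℤ (λ i → Z.∑ (divisors (ms i)) (h i)) ≡ Z.∑ (divisorTuples ms) (λ t → prodFinℤ (λ i → h i (t i)))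
  prod-∑-divisors {zero} ms h = P.refl
  prod-∑-divisors {suc r} ms h = begin
    Z.∑ D (h fzero) *ℤ prodFinℤ (λ i → Z.∑ (divisors (ms (fsuc i))) (h (fsuc i))) ≡⟨ cong (Z.∑ D (h fzero) *ℤ_) (prod-∑-divisors (ms ∘ fsuc) (h ∘ fsuc)) ⟩
    Z.∑ D (h fzero) *ℤ Z.∑ T g                                 ≡⟨ sym (Z.∑-*ʳ D (Z.∑ T g) (h fzero)) ⟩
    Z.∑ D (λ d → h fzero d *ℤ Z.∑ T g)                         ≡⟨ Z.∑-cong D (λ d → sym (Z.∑-*ˡ T (h fzero d) g)) ⟩
    Z.∑ D (λ d → Z.∑ T (λ t → h fzero d *ℤ g t))               ≡⟨ Z.∑-cong D (λ d → sym (Z.∑-map T (consF d) F)) ⟩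
    Z.∑ D (λ d → Z.∑ (map (consF d) T) F)                      ≡⟨ sym (Z.∑-concatMap (λ d → map (consF d) T) D F) ⟩
    Z.∑ (divisorTuples ms) F                                   ∎
    where
    open P.≡-Reasoning
    D : List ℕ
    D = divisors (ms fzero)
    T : List (Fin r → ℕ)
    T = divisorTuples (ms ∘ fsuc)
    g : (Fin r → ℕ) → ℤ
    g t = prodFinℤ (λ i → h (fsuc i) (t i))
    F : (Fin (suc r) → ℕ) → ℤ
    F t = prodFinℤ (λ i → h i (t i))


module Counting where
  open P using (cong; cong₂; sym; trans)
  open Residues
  open Families

  eval-≡-mod : ∀ (g : Poly) {x y n} → x ≡ y [mod n ] → eval g x ≡ eval g y [mod n ]
  eval-≡-mod [] x≡y = ≡-mod-refl
  eval-≡-mod (a ∷ as) x≡y = ≡-mod-+ (≡-mod-refl {a}) (≡-mod-* x≡y (eval-≡-mod as x≡y))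

  ∣-eval-periodic : ∀ d L k (g : Poly) .{{_ : NonZero L}} → d ∣ L →
                    Z.ind (d ∣? ∣ eval g (+ k) ∣) ≡ Z.ind (d ∣? ∣ eval g (+ (k % L)) ∣)
  ∣-eval-periodic d L k g d∣L = Z.ind-cong (d ∣? ∣ eval g (+ k) ∣) (d ∣? ∣ eval g (+ (k % L)) ∣) (≡-mod-∣ g[k]≡g[k%L]) (≡-mod-∣ (≡-mod-sym g[k]≡g[k%L]))
    where
    g[k]≡g[k%L] : eval g (+ k) ≡ eval g (+ (k % L)) [mod d ]
    g[k]≡g[k%L] = eval-≡-mod g (≡-mod-divisor d∣L (%-≡-mod k L))

  η-∑ : ∀ {r} (G : Fin r → Poly) (d : Fin r → ℕ) →
        + η G d ≡ Z.∑ (upTo (lcmF d)) (λ x → Z.ind (gcd x (lcmF d) ℕ.≟ 1) *ℤ prodFinℤ (λ i → Z.ind (d i ∣? ∣ eval (G i) (+ x) ∣)))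
  η-∑ G d = trans (length-filter-ℤ _ (upTo (lcmF d))) (Z.∑-cong (upTo (lcmF d)) term)
    where
    open P.≡-Reasoning
    term : ∀ x → Z.ind (all? (λ i → (d i ∣? ∣ eval (G i) (+ x) ∣) ×-dec (gcd x (d i) ℕ.≟ 1)))
               ≡ Z.ind (gcd x (lcmF d) ℕ.≟ 1) *ℤ prodFinℤ (λ i → Z.ind (d i ∣? ∣ eval (G i) (+ x) ∣))
    term x = begin
      Z.ind (all? (λ i → Div i ×-dec Cop i))                              ≡⟨ ind-all (λ i → Div i ×-dec Cop i) ⟩
      prodFinℤ (λ i → Z.ind (Div i ×-dec Cop i))                          ≡⟨ prodFinℤ-cong (λ i → Z.ind-× (Div i) (Cop i)) ⟩
      prodFinℤ (λ i → Z.ind (Div i) *ℤ Z.ind (Cop i))                     ≡⟨ prodFinℤ-* (λ i → Z.ind (Div i)) (λ i → Z.ind (Cop i)) ⟩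
      prodFinℤ (λ i → Z.ind (Div i)) *ℤ prodFinℤ (λ i → Z.ind (Cop i))    ≡⟨ cong (prodFinℤ (λ i → Z.ind (Div i)) *ℤ_) (sym (ind-all Cop)) ⟩
      prodFinℤ (λ i → Z.ind (Div i)) *ℤ Z.ind (all? Cop)                  ≡⟨ cong (prodFinℤ (λ i → Z.ind (Div i)) *ℤ_) coprime-to-all ⟩
      prodFinℤ (λ i → Z.ind (Div i)) *ℤ Z.ind (gcd x (lcmF d) ℕ.≟ 1)      ≡⟨ ℤₚ.*-comm (prodFinℤ (λ i → Z.ind (Div i))) (Z.ind (gcd x (lcmF d) ℕ.≟ 1)) ⟩
      Z.ind (gcd x (lcmF d) ℕ.≟ 1) *ℤ prodFinℤ (λ i → Z.ind (Div i))      ∎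
      where
      Div : ∀ i → Dec (d i ∣ ∣ eval (G i) (+ x) ∣)
      Div i = d i ∣? ∣ eval (G i) (+ x) ∣
      Cop : ∀ i → Dec (gcd x (d i) ≡ 1)
      Cop i = gcd x (d i) ℕ.≟ 1
      coprime-to-all : Z.ind (all? Cop) ≡ Z.ind (gcd x (lcmF d) ℕ.≟ 1)
      coprime-to-all = Z.ind-cong (all? Cop) (gcd x (lcmF d) ℕ.≟ 1)
        (λ h → coprime⇒gcd≡1 (coprime-lcmF d x (λ i → gcd≡1⇒coprime (h i))))
        (λ h i → coprime⇒gcd≡1 (lcmF-coprime d x (gcd≡1⇒coprime h) i))

  open Equidistribution

  count-for-tuple : ∀ {r} (G : Fin r → Poly) (ms : Fin r → ℕ) → (∀ i → 1 ≤ ms i) → ∀ d → (∀ i → d i ∣ ms i) →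
                    Z.∑ (coprimeList (lcmF ms)) (λ k → prodFinℤ (λ i → Z.ind (d i ∣? ∣ eval (G i) (+ k) ∣)))
                    ≡ + divN (φ (lcmF ms)) (φ (lcmF d)) *ℤ + η G d
  count-for-tuple G ms ms≥1 d d∣ms = begin
    Z.∑ (coprimeList m) Q                                            ≡⟨ Z.∑-cong (coprimeList m) (λ k → prodFinℤ-cong (λ i → ∣-eval-periodic (d i) L k (G i) (∣lcmF d i))) ⟩
    Z.∑ (coprimeList m) (λ k → Q (k % L))                            ≡⟨ equidistribution m L 1≤m (lcmF-mono d ms d∣ms) Q ⟩
    + f *ℤ Z.∑ (upTo L) (λ x → Z.ind (gcd x L ℕ.≟ 1) *ℤ Q x)         ≡⟨ cong₂ _*ℤ_ (cong +_ (sym φ-quotient)) (sym (η-∑ G d)) ⟩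
    + divN (φ m) (φ L) *ℤ + η G d                                    ∎
    where
    open P.≡-Reasoning
    m L : ℕ
    m = lcmF ms
    L = lcmF d
    Q : ℕ → ℤ
    Q k = prodFinℤ (λ i → Z.ind (d i ∣? ∣ eval (G i) (+ k) ∣))
    1≤m : 1 ≤ m
    1≤m = lcmF≥1 ms ms≥1
    1≤L : 1 ≤ L
    1≤L = lcmF≥1 d (λ i → divisor-pos (d∣ms i) (ms≥1 i))
    instance _ = ℕ.>-nonZero 1≤L
    f : ℕ
    f = unitClassCount m L
    φ-quotient : divN (φ m) (φ L) ≡ f
    φ-quotient = divN-exact f (φ L) (φ≥1 L 1≤L) (φ-multiple m L 1≤m (lcmF-mono d ms d∣ms))

  -- the theorem with c_{mᵢ} replaced by von Sterneck's expression, over ℤ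
  integer-identity : ∀ {r} (G : Fin r → Poly) (ms : Fin r → ℕ) → (∀ i → 1 ≤ ms i) →
                     Z.∑ (coprimeList (lcmF ms)) (λ k → prodFinℤ (λ i → vonSterneck (ms i) (eval (G i) (+ k)))) ≡ rhsℤ G ms
  integer-identity {r} G ms ms≥1 = begin
    Z.∑ C (λ k → prodFinℤ (λ i → vonSterneck (ms i) (eval (G i) (+ k))))
      ≡⟨ Z.∑-cong C (λ k → prod-∑-divisors ms (λ i d → a i d *ℤ divides-value i d k)) ⟩
    Z.∑ C (λ k → Z.∑ T (λ d → prodFinℤ (λ i → a i (d i) *ℤ divides-value i (d i) k)))
      ≡⟨ Z.∑-cong C (λ k → Z.∑-cong T (λ d → prodFinℤ-* (λ i → a i (d i)) (λ i → divides-value i (d i) k))) ⟩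
    Z.∑ C (λ k → Z.∑ T (λ d → weight d *ℤ Q d k))   ≡⟨ Z.∑-swap C T _ ⟩
    Z.∑ T (λ d → Z.∑ C (λ k → weight d *ℤ Q d k))   ≡⟨ Z.∑-cong T (λ d → Z.∑-*ˡ C (weight d) (Q d)) ⟩
    Z.∑ T (λ d → weight d *ℤ Z.∑ C (Q d))           ≡⟨ Z.∑-cong∈ T (λ d d∈T → trans (cong (weight d *ℤ_) (count-for-tuple G ms ms≥1 d (divisorTuples-∣ ms d d∈T)))
                                                                                   (rearrange (weight d) (+ divN (φ (lcmF ms)) (φ (lcmF d))) (+ η G d))) ⟩
    Z.∑ T term                                      ≡⟨ sym (sumℤ-map term T) ⟩
    rhsℤ G ms                                       ∎
    where
    open P.≡-Reasoning
    C : List ℕ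
    C = coprimeList (lcmF ms)
    T : List (Fin r → ℕ)
    T = divisorTuples ms
    a : Fin r → ℕ → ℤ
    a i d = + d *ℤ μ (divN (ms i) d)
    divides-value : Fin r → ℕ → ℕ → ℤ
    divides-value i d k = Z.ind (d ∣? ∣ eval (G i) (+ k) ∣)
    weight : (Fin r → ℕ) → ℤ
    weight d = prodFinℤ (λ i → a i (d i))
    Q : (Fin r → ℕ) → ℕ → ℤ
    Q d k = prodFinℤ (λ i → divides-value i (d i) k)
    term : (Fin r → ℕ) → ℤ
    term d = + divN (φ (lcmF ms)) (φ (lcmF d)) *ℤ weight d *ℤ + η G d
    rearrange : ∀ (w f e : ℤ) → w *ℤ (f *ℤ e) ≡ f *ℤ w *ℤ e
    rearrange = solve-∀
    sumℤ-map : (f : A → ℤ) (xs : List A) → sumℤ (map f xs) ≡ Z.∑ xs f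
    sumℤ-map f xs = Z.sumR-map xs f

-- The Kluyver–Ramanujan identity for a system of polynomials: ζ plays the
-- role of exp(2πi/m), m = lcm(mᵢ), so that ωᵢ = ζ^(m/mᵢ) is a primitive
-- mᵢ-th root of unity and each Ramanujan sum is von Sterneck's integer.
theorem2 : ∀ {c ℓ : Level} (R : CommutativeRing c ℓ) →
    let open CommutativeRing R in
    ¬ (1# ≈ 0#) →
    (∀ x y → x * y ≈ 0# → x ≈ 0# ⊎ y ≈ 0#) →
    (r : ℕ) (G : Fin r → Poly) (ms : Fin r → ℕ) →
    (∀ i → 1 ≤ ms i) →
    (ζ : Carrier) →
    pow R ζ (lcmF ms) ≈ 1# →
    (∀ t → 1 ≤ t → t < lcmF ms → ¬ (pow R ζ t ≈ 1#)) →
    RG R ζ G ms ≈ embedℤ R (rhsℤ G ms)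
theorem2 R _ no-zero-divisors r G ms ms≥1 ζ ζ^m≈1 ζ-no-smaller-period = begin
  RG R ζ G ms                                                                          ≡⟨ sumR-map C _ ⟩
  ∑ C (λ k → prodFinR R (λ i → ramanujan R (ω i) (ms i) (eval (G i) (+ k))))
    ≈⟨ ∑-cong C (λ k → prodFinR-cong (λ i → ramanujan-vonSterneck no-zero-divisors (ms i) (ω i) (ms≥1 i) (ω-primitive i) (eval (G i) (+ k)))) ⟩
  ∑ C (λ k → prodFinR R (λ i → E (vonSterneck (ms i) (eval (G i) (+ k)))))          ≈⟨ ∑-cong C (λ k → sym (E-prod (λ i → vonSterneck (ms i) (eval (G i) (+ k))))) ⟩
  ∑ C (λ k → E (prodFinℤ (λ i → vonSterneck (ms i) (eval (G i) (+ k)))))            ≈⟨ sym (E-∑ C _) ⟩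
  E (Z.∑ C (λ k → prodFinℤ (λ i → vonSterneck (ms i) (eval (G i) (+ k)))))            ≡⟨ P.cong E (Counting.integer-identity G ms ms≥1) ⟩
  E (rhsℤ G ms)                                                                        ∎
  where
  open CommutativeRing R
  open import Relation.Binary.Reasoning.Setoid setoid
  open Sum R using (∑; ∑-cong; sumR-map; prodFinR-cong)
  open Embedding R using (E; E-prod; E-∑)
  open RootsOfUnity R using (IsPrimitiveRoot; power-primitive)
  open Ramanujan R using (ramanujan-vonSterneck)
  open Residues using (divN-exact; factors-pos)
  open Families using (∣lcmF; lcmF≥1)
  m : ℕ
  m = lcmF ms
  C : List ℕ
  C = coprimeList m
  ω : Fin r → Carrier
  ω i = pow R ζ (divN m (ms i))
  ω-primitive : ∀ i → IsPrimitiveRoot (ω i) (ms i)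
  ω-primitive i with ∣lcmF ms i
  ... | divides k m≡kmᵢ = P.subst (λ e → IsPrimitiveRoot (pow R ζ e) (ms i)) (P.sym (divN-exact k (ms i) (ms≥1 i) m≡kmᵢ))
                            (power-primitive ζ m k (ms i) (proj₁ (factors-pos k (ms i) (lcmF≥1 ms ms≥1) m≡kmᵢ)) m≡kmᵢ (ζ^m≈1 , ζ-no-smaller-period))
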